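{- Let $q\ge0$, $t\ge1$, $k\ge1$ be integers and $Q_k=1+q+q^2+\dots+q^k$. If $\gcd(t,Q_k)=1$ then the critical group $K(\widetilde{W_k(q,t)})$ is cyclic. Otherwise, letting $d_1=\gcd(t,Q_k)$, one has $K(\widetilde{W_k(q,t)})\cong\mathbb{Z}/d_1\mathbb{Z}\times\mathbb{Z}/d_1d_2\mathbb{Z}$ for some positive integer $d_2$.
   Context: $W_{k+1}(q,t)$ is the directed multigraph with hub $v_0$ and rim vertices $v_1,\dots,v_{k+1}$ (clockwise, indices mod $k+1$), with $t$ edges each way between $v_0$ and each $v_i$, one edge $v_i\to v_{i-1}$ and $q$ edges $v_i\to v_{i+1}$. The graph $\widetilde{W_k(q,t)}$ is obtained from $W_{k+1}(q,t)$ by removing all edges (spokes) between $v_0$ and $v_1$. Its critical group $K(\widetilde{W_k(q,t)})$ (dollar game with bank $v_0$) is isomorphic to the cokernel $\mathbb{Z}^{k+1}/L\mathbb{Z}^{k+1}$ of its reduced Laplacian $L$ (the Laplacian with row and column of $v_0$ deleted; $L_{ii}$ is the out-degree of $v_i$ and $L_{ij}=-\#\{\text{edges } v_i\to v_j\}$ for $i\ne j$). -}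

module Defs where

open import Data.Nat as ℕ using (ℕ; zero; suc)
open import Data.Nat.DivMod using (_%_)
open import Data.Integer as ℤ using (ℤ; +_; _-_; -_)
open import Data.Integer.Divisibility using () renaming (_∣_ to _∣ℤ_)
open import Data.Fin using (Fin; toℕ)
open import Data.Bool using (if_then_else_)
open import Data.Product using (Σ; _×_; ∃; _,_)
open import Relation.Binary.PropositionalEquality using (_≡_)
open import Relation.Nullary.Decidable using (⌊_⌋)
open import Algebra.Bundles.Raw using (RawGroup)
open import Level using (0ℓ)
open import Algebra.Morphism.Structures using (module GroupMorphisms)
import Algebra.Construct.DirectProduct as DP

Qk : ℕ → ℕ → ℕ
Qk q zero    = 1
Qk q (suc k) = Qk q k ℕ.+ q ℕ.^ suc k

Σℤ : (n : ℕ) → (Fin n → ℤ) → ℤ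
Σℤ zero    f = + 0
Σℤ (suc n) f = f Fin.zero ℤ.+ Σℤ n (λ i → f (Fin.suc i))
  where import Data.Fin as Fin

-- Rim vertices v_1,...,v_{k+1} are indexed by i : Fin (suc k), i ↦ v_{toℕ i + 1}.
-- Number of edges v_i → v_j (i ≠ j) among rim vertices of W~_k(q,t):
-- one edge v_i → v_{i-1} and q edges v_i → v_{i+1} (indices mod k+1).
rimEdges : (q k : ℕ) → Fin (suc k) → Fin (suc k) → ℕ
rimEdges q k i j =
  (if ⌊ toℕ j ℕ.≟ ((toℕ i ℕ.+ k) % suc k) ⌋ then 1 else 0)
  ℕ.+ (if ⌊ toℕ j ℕ.≟ ((toℕ i ℕ.+ 1) % suc k) ⌋ then q else 0)

-- out-degree of v_i: t spokes to the hub (none for v_1, whose spokes were removed),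
-- plus 1 + q rim edges.
outDeg : (q t k : ℕ) → Fin (suc k) → ℕ
outDeg q t k i = (if ⌊ toℕ i ℕ.≟ 0 ⌋ then 0 else t) ℕ.+ 1 ℕ.+ q

-- reduced Laplacian of W~_k(q,t) (row and column of the hub v_0 deleted)
redLap : (q t k : ℕ) → Fin (suc k) → Fin (suc k) → ℤ
redLap q t k i j =
  if ⌊ toℕ i ℕ.≟ toℕ j ⌋ then + outDeg q t k i else - (+ rimEdges q k i j)

_·ᴹ_ : ∀ {n} → (Fin n → Fin n → ℤ) → (Fin n → ℤ) → (Fin n → ℤ)
_·ᴹ_ {n} M z i = Σℤ n (λ j → M i j ℤ.* z j)

coker : (n : ℕ) → (Fin n → Fin n → ℤ) → RawGroup 0ℓ 0ℓ
coker n M = record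
  { Carrier = Fin n → ℤ
  ; _≈_     = λ x y → ∃ λ (z : Fin n → ℤ) → ∀ i → x i - y i ≡ (M ·ᴹ z) i
  ; _∙_     = λ x y i → x i ℤ.+ y i
  ; ε       = λ _ → + 0
  ; _⁻¹     = λ x i → - x i
  }

K : (q t k : ℕ) → RawGroup 0ℓ 0ℓ
K q t k = coker (suc k) (redLap q t k)

ZMod : ℕ → RawGroup 0ℓ 0ℓ
ZMod d = record
  { Carrier = ℤ
  ; _≈_     = λ a b → (+ d) ∣ℤ (a - b)
  ; _∙_     = ℤ._+_
  ; ε       = + 0
  ; _⁻¹     = -_
  }

_×G_ : RawGroup 0ℓ 0ℓ → RawGroup 0ℓ 0ℓ → RawGroup 0ℓ 0ℓ
G ×G H = DP.rawGroup G H

module _ (G : RawGroup 0ℓ 0ℓ) where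
  open RawGroup G
  _^ℕ_ : Carrier → ℕ → Carrier
  g ^ℕ zero  = ε
  g ^ℕ suc n = g ∙ (g ^ℕ n)

  _^ℤ_ : Carrier → ℤ → Carrier
  g ^ℤ (+ n)      = g ^ℕ n
  g ^ℤ ℤ.-[1+ n ] = (g ^ℕ suc n) ⁻¹

Cyclic : RawGroup 0ℓ 0ℓ → Set
Cyclic G = Σ Carrier λ g → ∀ x → ∃ λ (n : ℤ) → x ≈ _^ℤ_ G g n
  where open RawGroup G

_≅_ : RawGroup 0ℓ 0ℓ → RawGroup 0ℓ 0ℓ → Set
G ≅ H = ∃ λ (f : RawGroup.Carrier G → RawGroup.Carrier H) →
          GroupMorphisms.IsGroupIsomorphism G H f

module Submission where

-- Removing the spokes at v₁ leaves a reduced Laplacian L whose rows at v₃, …, v_{k+1}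
-- have coefficient −1 at the preceding rim vertex, so they can be solved from the top
-- down.  This back-substitution identifies coker L with ℤ²/Rℤ² for a 2 × 2 integer
-- matrix R.  The entries of R are values of B_{n+2} = (t+1+q) B_{n+1} − q B_n with
-- B₀ = 0, B₁ = 1; modulo t this is the recurrence of Q_{n−1}, so every entry of R is
-- ±Q_k modulo t, while t is itself an integer combination of the entries.  Hence the gcd
-- of the entries is gcd(t, Q_k), and a Smith normal form of R, reached by Euclidean row
-- and column operations, gives K ≅ ℤ/d₁ × ℤ/d₁d₂ with d₁ = gcd(t, Q_k); finally d₂ ≠ 0
-- because det R > 0 when t ≥ 1.

open import Defs
open import Data.Nat as ℕ using (ℕ; zero; suc; _∸_; _≤_; _<_; s≤s; z≤n)
import Data.Nat.Properties as ℕₚ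
import Data.Nat.Divisibility as ℕᵈ
open import Data.Nat.DivMod using (m≤n⇒m%n≡m; n%n≡0; [m+n]%n≡m%n)
open import Data.Nat.GCD using (gcd; gcd[m,n]∣m; gcd[m,n]∣n; gcd-greatest)
import Data.Nat.Tactic.RingSolver as ℕ-Ring
open import Data.Integer as ℤ using (ℤ; +_; -[1+_]; _+_; _-_; -_; _*_; NonZero)
import Data.Integer.Properties as ℤₚ
open import Data.Integer.DivMod using (_/_; _%_; a≡a%n+[a/n]*n; n%d<d)
open import Data.Integer.Divisibility.Signed
open import Data.Integer.Tactic.RingSolver using (solve-∀)
open import Data.Fin using (Fin; toℕ; fromℕ<) renaming (zero to fzero; suc to fsuc)
open import Data.Fin.Properties using (toℕ<n; toℕ-fromℕ<)
open import Data.Bool using (if_then_else_)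
open import Data.Empty using (⊥-elim)
open import Data.Product using (∃; _×_; _,_; proj₁; proj₂)
open import Data.Sum using (inj₁; inj₂)
open import Relation.Nullary using (yes; no)
open import Relation.Nullary.Decidable using (⌊_⌋)
open import Relation.Binary.PropositionalEquality
open import Relation.Binary.Definitions using (Transitive)
open import Algebra.Bundles.Raw using (RawGroup)
open import Algebra.Morphism.Structures using (module GroupMorphisms)
import Algebra.Morphism.Construct.Composition as Composition
open import Function.Definitions using (Congruent; Injective; Surjective)
open import Level using (0ℓ)

Σℤ-cong : ∀ n {f g : Fin n → ℤ} → (∀ i → f i ≡ g i) → Σℤ n f ≡ Σℤ n g
Σℤ-cong zero    f≡g = refl
Σℤ-cong (suc n) f≡g = cong₂ _+_ (f≡g fzero) (Σℤ-cong n (λ i → f≡g (fsuc i)))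

Σℤ-+ : ∀ n (f g : Fin n → ℤ) → Σℤ n (λ i → f i + g i) ≡ Σℤ n f + Σℤ n g
Σℤ-+ zero    f g = refl
Σℤ-+ (suc n) f g
  rewrite Σℤ-+ n (λ i → f (fsuc i)) (λ i → g (fsuc i)) =
    interchange (f fzero) (g fzero) (Σℤ n (λ i → f (fsuc i))) (Σℤ n (λ i → g (fsuc i)))
  where
  interchange : ∀ a b c d → a + b + (c + d) ≡ a + c + (b + d)
  interchange = solve-∀

Σℤ-zero : ∀ n → Σℤ n (λ _ → + 0) ≡ + 0
Σℤ-zero zero    = refl
Σℤ-zero (suc n) = trans (ℤₚ.+-identityˡ _) (Σℤ-zero n)

-- Entry m of a vector, read as 0 outside the range.
at : ∀ {n} → (Fin n → ℤ) → ℕ → ℤ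
at {zero}  z m       = + 0
at {suc n} z zero    = z fzero
at {suc n} z (suc m) = at (λ j → z (fsuc j)) m

at-toℕ : ∀ {n} (z : Fin n → ℤ) i → at z (toℕ i) ≡ z i
at-toℕ z fzero    = refl
at-toℕ z (fsuc i) = at-toℕ (λ j → z (fsuc j)) i

at-cong : ∀ {n} {x y : Fin n → ℤ} → (∀ i → x i ≡ y i) → ∀ m → at x m ≡ at y m
at-cong {zero}  x≡y m       = refl
at-cong {suc n} x≡y zero    = x≡y fzero
at-cong {suc n} x≡y (suc m) = at-cong (λ i → x≡y (fsuc i)) m

at-≥ : ∀ {n} (z : Fin n → ℤ) {m} → n ≤ m → at z m ≡ + 0
at-≥ {zero}  z         _         = refl
at-≥ {suc n} z {suc m} (s≤s n≤m) = at-≥ (λ j → z (fsuc j)) n≤m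

at-tabulate : ∀ {n} (F : ℕ → ℤ) {m} → m < n → at {n} (λ i → F (toℕ i)) m ≡ F m
at-tabulate {suc n} F {zero}  _         = refl
at-tabulate {suc n} F {suc m} (s≤s m<n) = at-tabulate (λ j → F (suc j)) m<n

at-+ : ∀ {n} (x y : Fin n → ℤ) m → at (λ i → x i + y i) m ≡ at x m + at y m
at-+ {zero}  x y m       = refl
at-+ {suc n} x y zero    = refl
at-+ {suc n} x y (suc m) = at-+ (λ j → x (fsuc j)) (λ j → y (fsuc j)) m

at-zero : ∀ {n} m → at {n} (λ _ → + 0) m ≡ + 0
at-zero {zero}  m       = refl
at-zero {suc n} zero    = refl
at-zero {suc n} (suc m) = at-zero {n} m

pick : ℕ → ℕ → ℤ → ℤ
pick m n c = if ⌊ m ℕ.≟ n ⌋ then c else + 0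

pick-suc : ∀ m n c → pick (suc m) (suc n) c ≡ pick m n c
pick-suc m n c with m ℕ.≟ n | suc m ℕ.≟ suc n
... | yes _   | yes _     = refl
... | no _    | no _      = refl
... | yes m≡n | no m≢n    = ⊥-elim (m≢n (cong suc m≡n))
... | no m≢n  | yes m≡n   = ⊥-elim (m≢n (ℕₚ.suc-injective m≡n))

Σℤ-pick : ∀ n (z : Fin n → ℤ) m c → Σℤ n (λ j → pick (toℕ j) m c * z j) ≡ c * at z m
Σℤ-pick zero    z m       c = sym (ℤₚ.*-zeroʳ c)
Σℤ-pick (suc n) z zero    c = begin
  c * z fzero + Σℤ n (λ j → pick (suc (toℕ j)) 0 c * z (fsuc j))
    ≡⟨ cong (λ w → c * z fzero + w) (Σℤ-cong n (λ j → ℤₚ.*-zeroˡ (z (fsuc j)))) ⟩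
  c * z fzero + Σℤ n (λ _ → + 0)
    ≡⟨ cong (λ w → c * z fzero + w) (Σℤ-zero n) ⟩
  c * z fzero + + 0
    ≡⟨ ℤₚ.+-identityʳ _ ⟩
  c * z fzero ∎
  where open ≡-Reasoning
Σℤ-pick (suc n) z (suc m) c = begin
  + 0 * z fzero + Σℤ n (λ j → pick (suc (toℕ j)) (suc m) c * z (fsuc j))
    ≡⟨ cong₂ _+_ (ℤₚ.*-zeroˡ (z fzero))
         (Σℤ-cong n (λ j → cong (_* z (fsuc j)) (pick-suc (toℕ j) m c))) ⟩
  + 0 + Σℤ n (λ j → pick (toℕ j) m c * z (fsuc j))
    ≡⟨ ℤₚ.+-identityˡ _ ⟩
  Σℤ n (λ j → pick (toℕ j) m c * z (fsuc j))
    ≡⟨ Σℤ-pick n (λ j → z (fsuc j)) m c ⟩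
  c * at (λ j → z (fsuc j)) m ∎
  where open ≡-Reasoning

·ᴹ-zero : ∀ {n} (M : Fin n → Fin n → ℤ) i → (M ·ᴹ (λ _ → + 0)) i ≡ + 0
·ᴹ-zero {n} M i = trans (Σℤ-cong n (λ j → ℤₚ.*-zeroʳ (M i j))) (Σℤ-zero n)

-- Cokernels of 2 × 2 integer matrices

record Mat₂ : Set where
  constructor mat
  field a b c d : ℤ

infixl 7 _⊗_ _·_
infixl 6 _+²_ _-²_
infix 8 -²_

_⊗_ : Mat₂ → Mat₂ → Mat₂
mat a b c d ⊗ mat a′ b′ c′ d′ =
  mat (a * a′ + b * c′) (a * b′ + b * d′) (c * a′ + d * c′) (c * b′ + d * d′)

det : Mat₂ → ℤ
det (mat a b c d) = a * d - b * c

adj : Mat₂ → Mat₂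
adj (mat a b c d) = mat d (- b) (- c) a

ℤ² : Set
ℤ² = ℤ × ℤ

_·_ : Mat₂ → ℤ² → ℤ²
mat a b c d · (x , y) = (a * x + b * y , c * x + d * y)

_+²_ _-²_ : ℤ² → ℤ² → ℤ²
(x , y) +² (x′ , y′) = (x + x′ , y + y′)
(x , y) -² (x′ , y′) = (x - x′ , y - y′)

-²_ : ℤ² → ℤ²
-² (x , y) = (- x , - y)

0² : ℤ²
0² = (+ 0 , + 0)

·-distrib-+² : ∀ M v w → M · (v +² w) ≡ M · v +² M · w
·-distrib-+² (mat a b c d) (v₁ , v₂) (w₁ , w₂) = cong₂ _,_ (distrib a b v₁ v₂ w₁ w₂) (distrib c d v₁ v₂ w₁ w₂)
  where
  distrib : ∀ a b v₁ v₂ w₁ w₂ → a * (v₁ + w₁) + b * (v₂ + w₂) ≡ (a * v₁ + b * v₂) + (a * w₁ + b * w₂)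
  distrib = solve-∀

·-distrib-diff² : ∀ M v w → M · (v -² w) ≡ M · v -² M · w
·-distrib-diff² (mat a b c d) (v₁ , v₂) (w₁ , w₂) = cong₂ _,_ (distrib a b v₁ v₂ w₁ w₂) (distrib c d v₁ v₂ w₁ w₂)
  where
  distrib : ∀ a b v₁ v₂ w₁ w₂ → a * (v₁ - w₁) + b * (v₂ - w₂) ≡ (a * v₁ + b * v₂) - (a * w₁ + b * w₂)
  distrib = solve-∀

·-distrib-neg² : ∀ M v → M · (-² v) ≡ -² (M · v)
·-distrib-neg² (mat a b c d) (v₁ , v₂) = cong₂ _,_ (distrib a b v₁ v₂) (distrib c d v₁ v₂)
  where
  distrib : ∀ a b v₁ v₂ → a * (- v₁) + b * (- v₂) ≡ - (a * v₁ + b * v₂)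
  distrib = solve-∀

·-0² : ∀ M → M · 0² ≡ 0²
·-0² (mat a b c d) = cong₂ _,_ (annihilate a b) (annihilate c d)
  where
  annihilate : ∀ a b → a * + 0 + b * + 0 ≡ + 0
  annihilate = solve-∀

·-⊗ : ∀ U R w → (U ⊗ R) · w ≡ U · (R · w)
·-⊗ (mat u₁ u₂ u₃ u₄) (mat a b c d) (w₁ , w₂) = cong₂ _,_ (assoc u₁ u₂ a b c d w₁ w₂) (assoc u₃ u₄ a b c d w₁ w₂)
  where
  assoc : ∀ u v a b c d w₁ w₂ → (u * a + v * c) * w₁ + (u * b + v * d) * w₂ ≡ u * (a * w₁ + b * w₂) + v * (c * w₁ + d * w₂)
  assoc = solve-∀

adj-· : ∀ U v → det U ≡ + 1 → adj U · (U · v) ≡ v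
adj-· (mat a b c d) (v₁ , v₂) det≡1 = cong₂ _,_
  (trans (cramer₁ a b c d v₁ v₂) (unit v₁)) (trans (cramer₂ a b c d v₁ v₂) (unit v₂))
  where
  cramer₁ : ∀ a b c d v₁ v₂ → d * (a * v₁ + b * v₂) + - b * (c * v₁ + d * v₂) ≡ (a * d - b * c) * v₁
  cramer₁ = solve-∀
  cramer₂ : ∀ a b c d v₁ v₂ → - c * (a * v₁ + b * v₂) + a * (c * v₁ + d * v₂) ≡ (a * d - b * c) * v₂
  cramer₂ = solve-∀
  unit : ∀ x → (a * d - b * c) * x ≡ x
  unit x = trans (cong (_* x) det≡1) (ℤₚ.*-identityˡ x)

·-adj : ∀ U v → det U ≡ + 1 → U · (adj U · v) ≡ v
·-adj (mat a b c d) (v₁ , v₂) det≡1 = cong₂ _,_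
  (trans (cramer₁ a b c d v₁ v₂) (unit v₁)) (trans (cramer₂ a b c d v₁ v₂) (unit v₂))
  where
  cramer₁ : ∀ a b c d v₁ v₂ → a * (d * v₁ + - b * v₂) + b * (- c * v₁ + a * v₂) ≡ (a * d - b * c) * v₁
  cramer₁ = solve-∀
  cramer₂ : ∀ a b c d v₁ v₂ → c * (d * v₁ + - b * v₂) + d * (- c * v₁ + a * v₂) ≡ (a * d - b * c) * v₂
  cramer₂ = solve-∀
  unit : ∀ x → (a * d - b * c) * x ≡ x
  unit x = trans (cong (_* x) det≡1) (ℤₚ.*-identityˡ x)

Coker₂ : Mat₂ → RawGroup 0ℓ 0ℓ
Coker₂ M = record
  { Carrier = ℤ²
  ; _≈_     = λ x y → ∃ λ w → x -² y ≡ M · w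
  ; _∙_     = _+²_
  ; ε       = 0²
  ; _⁻¹     = -²_
  }

module _ (M : Mat₂) where
  open RawGroup (Coker₂ M)

  Coker₂-refl : ∀ x → x ≈ x
  Coker₂-refl (x₁ , x₂) = 0² , cong₂ _,_ (cancel x₁ a b) (cancel x₂ c d)
    where
    open Mat₂ M
    cancel : ∀ x a b → x - x ≡ a * + 0 + b * + 0
    cancel = solve-∀

  Coker₂-reflexive : ∀ {x y} → x ≡ y → x ≈ y
  Coker₂-reflexive {x} refl = Coker₂-refl x

  Coker₂-trans : Transitive _≈_
  Coker₂-trans {x₁ , x₂} {y₁ , y₂} {z₁ , z₂} (v , x-y≡Mv) (w , y-z≡Mw) =
    v +² w , (begin
      (x₁ - z₁ , x₂ - z₂)               ≡⟨ cong₂ _,_ (telescope x₁ y₁ z₁) (telescope x₂ y₂ z₂) ⟩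
      (x₁ - y₁ , x₂ - y₂) +² (y₁ - z₁ , y₂ - z₂) ≡⟨ cong₂ _+²_ x-y≡Mv y-z≡Mw ⟩
      M · v +² M · w                    ≡⟨ ·-distrib-+² M v w ⟨
      M · (v +² w)                      ∎)
    where
    open ≡-Reasoning
    telescope : ∀ x y z → x - z ≡ (x - y) + (y - z)
    telescope = solve-∀

module _ {G H : RawGroup 0ℓ 0ℓ} where
  private
    module G = RawGroup G
    module H = RawGroup H

  isomorphism : (f : G.Carrier → H.Carrier) → Congruent G._≈_ H._≈_ f →
                (∀ x y → f (x G.∙ y) H.≈ (f x H.∙ f y)) → f G.ε H.≈ H.ε →
                (∀ x → f (x G.⁻¹) H.≈ (f x H.⁻¹)) →
                Injective G._≈_ H._≈_ f → Surjective G._≈_ H._≈_ f → G ≅ H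
  isomorphism f f-cong ∙-homo ε-homo ⁻¹-homo injective surjective = f , record
    { isGroupMonomorphism = record
      { isGroupHomomorphism = record
        { isMonoidHomomorphism = record
          { isMagmaHomomorphism = record
            { isRelHomomorphism = record { cong = f-cong }
            ; homo = ∙-homo }
          ; ε-homo = ε-homo }
        ; ⁻¹-homo = ⁻¹-homo }
      ; injective = injective }
    ; surjective = surjective }

≅-trans : ∀ {G H J} → Transitive (RawGroup._≈_ J) → G ≅ H → H ≅ J → G ≅ J
≅-trans J-trans (f , f-iso) (g , g-iso) =
  (λ x → g (f x)) , Composition.isGroupIsomorphism J-trans f-iso g-iso

mat-≡ : ∀ {a b c d a′ b′ c′ d′} → a ≡ a′ → b ≡ b′ → c ≡ c′ → d ≡ d′ →
        mat a b c d ≡ mat a′ b′ c′ d′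
mat-≡ refl refl refl refl = refl

det-⊗ : ∀ M N → det (M ⊗ N) ≡ det M * det N
det-⊗ (mat a b c d) (mat a′ b′ c′ d′) = multiplicative a b c d a′ b′ c′ d′
  where
  multiplicative : ∀ a b c d a′ b′ c′ d′ →
    (a * a′ + b * c′) * (c * b′ + d * d′) - (a * b′ + b * d′) * (c * a′ + d * c′)
      ≡ (a * d - b * c) * (a′ * d′ - b′ * c′)
  multiplicative = solve-∀

adj-⊗ : ∀ U R → det U ≡ + 1 → adj U ⊗ (U ⊗ R) ≡ R
adj-⊗ (mat u₁ u₂ u₃ u₄) (mat a b c d) det≡1 = mat-≡
  (trans (cramer₁ u₁ u₂ u₃ u₄ a c) (unit a)) (trans (cramer₁ u₁ u₂ u₃ u₄ b d) (unit b))
  (trans (cramer₂ u₁ u₂ u₃ u₄ a c) (unit c)) (trans (cramer₂ u₁ u₂ u₃ u₄ b d) (unit d))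
  where
  cramer₁ : ∀ u₁ u₂ u₃ u₄ x y → u₄ * (u₁ * x + u₂ * y) + - u₂ * (u₃ * x + u₄ * y) ≡ (u₁ * u₄ - u₂ * u₃) * x
  cramer₁ = solve-∀
  cramer₂ : ∀ u₁ u₂ u₃ u₄ x y → - u₃ * (u₁ * x + u₂ * y) + u₁ * (u₃ * x + u₄ * y) ≡ (u₁ * u₄ - u₂ * u₃) * y
  cramer₂ = solve-∀
  unit : ∀ x → (u₁ * u₄ - u₂ * u₃) * x ≡ x
  unit x = trans (cong (_* x) det≡1) (ℤₚ.*-identityˡ x)

⊗-adj : ∀ R V → det V ≡ + 1 → (R ⊗ V) ⊗ adj V ≡ R
⊗-adj (mat a b c d) (mat v₁ v₂ v₃ v₄) det≡1 = mat-≡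
  (trans (cramer₁ v₁ v₂ v₃ v₄ a b) (unit a)) (trans (cramer₂ v₁ v₂ v₃ v₄ a b) (unit b))
  (trans (cramer₁ v₁ v₂ v₃ v₄ c d) (unit c)) (trans (cramer₂ v₁ v₂ v₃ v₄ c d) (unit d))
  where
  cramer₁ : ∀ v₁ v₂ v₃ v₄ x y → (x * v₁ + y * v₃) * v₄ + (x * v₂ + y * v₄) * - v₃ ≡ (v₁ * v₄ - v₂ * v₃) * x
  cramer₁ = solve-∀
  cramer₂ : ∀ v₁ v₂ v₃ v₄ x y → (x * v₁ + y * v₃) * - v₂ + (x * v₂ + y * v₄) * v₁ ≡ (v₁ * v₄ - v₂ * v₃) * y
  cramer₂ = solve-∀
  unit : ∀ x → (v₁ * v₄ - v₂ * v₃) * x ≡ x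
  unit x = trans (cong (_* x) det≡1) (ℤₚ.*-identityˡ x)

infix 4 _∣ᴹ_ _∼_
_∣ᴹ_ : ℤ → Mat₂ → Set
m ∣ᴹ mat a b c d = m ∣ a × m ∣ b × m ∣ c × m ∣ d

∣-combination : ∀ {m x y} u v → m ∣ x → m ∣ y → m ∣ u * x + v * y
∣-combination u v m∣x m∣y = ∣m∣n⇒∣m+n (∣n⇒∣m*n u m∣x) (∣n⇒∣m*n v m∣y)

∣-combinationʳ : ∀ {m x y} u v → m ∣ x → m ∣ y → m ∣ x * u + y * v
∣-combinationʳ u v m∣x m∣y = ∣m∣n⇒∣m+n (∣m⇒∣m*n u m∣x) (∣m⇒∣m*n v m∣y)

∣ᴹ-⊗ˡ : ∀ {m} U R → m ∣ᴹ R → m ∣ᴹ U ⊗ R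
∣ᴹ-⊗ˡ (mat u₁ u₂ u₃ u₄) (mat a b c d) (m∣a , m∣b , m∣c , m∣d) =
  ∣-combination u₁ u₂ m∣a m∣c , ∣-combination u₁ u₂ m∣b m∣d ,
  ∣-combination u₃ u₄ m∣a m∣c , ∣-combination u₃ u₄ m∣b m∣d

∣ᴹ-⊗ʳ : ∀ {m} R V → m ∣ᴹ R → m ∣ᴹ R ⊗ V
∣ᴹ-⊗ʳ (mat a b c d) (mat v₁ v₂ v₃ v₄) (m∣a , m∣b , m∣c , m∣d) =
  ∣-combinationʳ v₁ v₃ m∣a m∣b , ∣-combinationʳ v₂ v₄ m∣a m∣b ,
  ∣-combinationʳ v₁ v₃ m∣c m∣d , ∣-combinationʳ v₂ v₄ m∣c m∣d

-- Equivalence of matrices, recorded through the invariants it preserves.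
record _∼_ (R S : Mat₂) : Set where
  field
    coker≅    : Coker₂ R ≅ Coker₂ S
    det≡      : det S ≡ det R
    divisors  : ∀ {m} → m ∣ᴹ R → m ∣ᴹ S
    divisors⁻ : ∀ {m} → m ∣ᴹ S → m ∣ᴹ R

∼-trans : ∀ {R S T} → R ∼ S → S ∼ T → R ∼ T
∼-trans {T = T} R∼S S∼T = record
  { coker≅    = ≅-trans {J = Coker₂ T} (λ {x} {y} {z} → Coker₂-trans T {x} {y} {z}) (R∼S.coker≅) (S∼T.coker≅)
  ; det≡      = trans S∼T.det≡ R∼S.det≡
  ; divisors  = λ m∣R → S∼T.divisors (R∼S.divisors m∣R)
  ; divisors⁻ = λ m∣T → R∼S.divisors⁻ (S∼T.divisors⁻ m∣T)
  }
  where
  module R∼S = _∼_ R∼S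
  module S∼T = _∼_ S∼T

∼-≡ : ∀ {R S S′} → R ∼ S → S ≡ S′ → R ∼ S′
∼-≡ R∼S refl = R∼S

row-op : ∀ U R → det U ≡ + 1 → R ∼ U ⊗ R
row-op U R det≡1 = record
  { coker≅    = isomorphism {Coker₂ R} {Coker₂ (U ⊗ R)} (U ·_) (λ {x} {y} → U-cong {x} {y})
                  (λ x y → Coker₂-reflexive (U ⊗ R) {U · (x +² y)} (·-distrib-+² U x y))
                  (Coker₂-reflexive (U ⊗ R) {U · 0²} (·-0² U))
                  (λ x → Coker₂-reflexive (U ⊗ R) {U · (-² x)} (·-distrib-neg² U x))
                  (λ {x} {y} → U-injective {x} {y}) U-surjective
  ; det≡      = trans (det-⊗ U R) (trans (cong (_* det R) det≡1) (ℤₚ.*-identityˡ (det R)))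
  ; divisors  = ∣ᴹ-⊗ˡ U R
  ; divisors⁻ = λ {m} m∣UR → subst (m ∣ᴹ_) (adj-⊗ U R det≡1) (∣ᴹ-⊗ˡ (adj U) (U ⊗ R) m∣UR)
  }
  where
  open ≡-Reasoning
  U-cong : Congruent (RawGroup._≈_ (Coker₂ R)) (RawGroup._≈_ (Coker₂ (U ⊗ R))) (U ·_)
  U-cong {x} {y} (w , x-y≡Rw) = w , (begin
    U · x -² U · y  ≡⟨ ·-distrib-diff² U x y ⟨
    U · (x -² y)    ≡⟨ cong (U ·_) x-y≡Rw ⟩
    U · (R · w)     ≡⟨ ·-⊗ U R w ⟨
    (U ⊗ R) · w     ∎)
  U-injective : Injective (RawGroup._≈_ (Coker₂ R)) (RawGroup._≈_ (Coker₂ (U ⊗ R))) (U ·_)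
  U-injective {x} {y} (w , Ux-Uy≡URw) = w , (begin
    x -² y                  ≡⟨ adj-· U (x -² y) det≡1 ⟨
    adj U · (U · (x -² y))  ≡⟨ cong (adj U ·_) (·-distrib-diff² U x y) ⟩
    adj U · (U · x -² U · y) ≡⟨ cong (adj U ·_) (trans Ux-Uy≡URw (·-⊗ U R w)) ⟩
    adj U · (U · (R · w))   ≡⟨ adj-· U (R · w) det≡1 ⟩
    R · w                   ∎)
  U-surjective : Surjective (RawGroup._≈_ (Coker₂ R)) (RawGroup._≈_ (Coker₂ (U ⊗ R))) (U ·_)
  U-surjective y = adj U · y , λ {z} z≈ →
    subst (RawGroup._≈_ (Coker₂ (U ⊗ R)) (U · z)) (·-adj U y det≡1) (U-cong {z} {adj U · y} z≈)

col-op : ∀ R V → det V ≡ + 1 → R ∼ R ⊗ V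
col-op R V det≡1 = record
  { coker≅    = isomorphism {Coker₂ R} {Coker₂ (R ⊗ V)} (λ x → x) (λ {x} {y} → V-cong {x} {y})
                  (λ x y → Coker₂-refl (R ⊗ V) (x +² y))
                  (Coker₂-refl (R ⊗ V) 0²)
                  (λ x → Coker₂-refl (R ⊗ V) (-² x))
                  (λ {x} {y} → V-injective {x} {y}) (λ y → y , λ {z} → V-cong {z} {y})
  ; det≡      = trans (det-⊗ R V) (trans (cong (det R *_) det≡1) (ℤₚ.*-identityʳ (det R)))
  ; divisors  = ∣ᴹ-⊗ʳ R V
  ; divisors⁻ = λ {m} m∣RV → subst (m ∣ᴹ_) (⊗-adj R V det≡1) (∣ᴹ-⊗ʳ (R ⊗ V) (adj V) m∣RV)
  }
  where
  V-cong : Congruent (RawGroup._≈_ (Coker₂ R)) (RawGroup._≈_ (Coker₂ (R ⊗ V))) (λ x → x)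
  V-cong (w , x-y≡Rw) = adj V · w ,
    trans x-y≡Rw (trans (cong (R ·_) (sym (·-adj V w det≡1))) (sym (·-⊗ R V (adj V · w))))
  V-injective : Injective (RawGroup._≈_ (Coker₂ R)) (RawGroup._≈_ (Coker₂ (R ⊗ V))) (λ x → x)
  V-injective (w , x-y≡RVw) = V · w , trans x-y≡RVw (·-⊗ R V w)

-- Smith normal form

add-row : ∀ a b c d k → mat a b c d ∼ mat a b (c + k * a) (d + k * b)
add-row a b c d k = ∼-≡ (row-op (mat (+ 1) (+ 0) k (+ 1)) (mat a b c d) (unimodular k))
  (mat-≡ (unitˡ a c) (unitˡ b d) (shearˡ a c k) (shearˡ b d k))
  where
  unimodular : ∀ k → + 1 * + 1 - + 0 * k ≡ + 1
  unimodular = solve-∀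
  unitˡ : ∀ x y → + 1 * x + + 0 * y ≡ x
  unitˡ = solve-∀
  shearˡ : ∀ x y k → k * x + + 1 * y ≡ y + k * x
  shearˡ = solve-∀

add-row↑ : ∀ a b c d k → mat a b c d ∼ mat (a + k * c) (b + k * d) c d
add-row↑ a b c d k = ∼-≡ (row-op (mat (+ 1) k (+ 0) (+ 1)) (mat a b c d) (unimodular k))
  (mat-≡ (shear a c k) (shear b d k) (unitʳ a c) (unitʳ b d))
  where
  unimodular : ∀ k → + 1 * + 1 - k * + 0 ≡ + 1
  unimodular = solve-∀
  shear : ∀ x y k → + 1 * x + k * y ≡ x + k * y
  shear = solve-∀
  unitʳ : ∀ x y → + 0 * x + + 1 * y ≡ y
  unitʳ = solve-∀

add-col : ∀ a b c d k → mat a b c d ∼ mat a (b + k * a) c (d + k * c)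
add-col a b c d k = ∼-≡ (col-op (mat a b c d) (mat (+ 1) k (+ 0) (+ 1)) (unimodular k))
  (mat-≡ (unit a b) (shear a b k) (unit c d) (shear c d k))
  where
  unimodular : ∀ k → + 1 * + 1 - k * + 0 ≡ + 1
  unimodular = solve-∀
  unit : ∀ x y → x * + 1 + y * + 0 ≡ x
  unit = solve-∀
  shear : ∀ x y k → x * k + y * + 1 ≡ y + k * x
  shear = solve-∀

rotate-rows : ∀ a b c d → mat a b c d ∼ mat c d (- a) (- b)
rotate-rows a b c d = ∼-≡ (row-op (mat (+ 0) (+ 1) (- + 1) (+ 0)) (mat a b c d) refl)
  (mat-≡ (second a c) (second b d) (negate a c) (negate b d))
  where
  second : ∀ x y → + 0 * x + + 1 * y ≡ y
  second = solve-∀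
  negate : ∀ x y → - + 1 * x + + 0 * y ≡ - x
  negate = solve-∀

rotate-cols : ∀ a b c d → mat a b c d ∼ mat b (- a) d (- c)
rotate-cols a b c d = ∼-≡ (col-op (mat a b c d) (mat (+ 0) (- + 1) (+ 1) (+ 0)) refl)
  (mat-≡ (second a b) (negate a b) (second c d) (negate c d))
  where
  second : ∀ x y → x * + 0 + y * + 1 ≡ y
  second = solve-∀
  negate : ∀ x y → x * - + 1 + y * + 0 ≡ - x
  negate = solve-∀

remainder : ∀ x a .{{_ : NonZero a}} → x + - (x / a) * a ≡ + (x % a)
remainder x a = begin
  x + - (x / a) * a                    ≡⟨ cong (λ y → y + - (x / a) * a) (a≡a%n+[a/n]*n x a) ⟩
  + (x % a) + (x / a) * a + - (x / a) * a ≡⟨ cancel (+ (x % a)) (x / a) a ⟩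
  + (x % a)                            ∎
  where
  open ≡-Reasoning
  cancel : ∀ r q a → r + q * a + - q * a ≡ r
  cancel = solve-∀

∼-refl : ∀ R → R ∼ R
∼-refl (mat a b c d) = ∼-≡ (add-row a b c d (+ 0)) (mat-≡ refl refl (vanish c a) (vanish d b))
  where
  vanish : ∀ x y → x + + 0 * y ≡ x
  vanish = solve-∀

record SmithForm (R : Mat₂) : Set where
  constructor smithForm
  field
    e f        : ℤ
    equivalent : R ∼ mat e (+ 0) (+ 0) f
    e∣f        : e ∣ f

SmithForm-∼ : ∀ {R S} → R ∼ S → SmithForm S → SmithForm R
SmithForm-∼ R∼S (smithForm e f S∼D e∣f) = smithForm e f (∼-trans R∼S S∼D) e∣f

private
  SmithBelow : ℕ → Set
  SmithBelow n = ∀ R → Mat₂.a R ≢ + 0 → ℤ.∣ Mat₂.a R ∣ ≤ n → SmithForm R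

  descend : ∀ {n R S r} → SmithBelow n → R ∼ S → Mat₂.a S ≡ + suc r →
            suc r < suc n → SmithForm R
  descend recurse R∼S corner r<n = SmithForm-∼ R∼S
    (recurse _ (λ corner≡0 → ℕₚ.1+n≢0 (ℤₚ.+-injective (trans (sym corner) corner≡0)))
               (subst (λ x → ℤ.∣ x ∣ ≤ _) (sym corner) (ℕ.s≤s⁻¹ r<n)))

  remainder<fuel : ∀ x a .{{_ : NonZero a}} {r n} → x % a ≡ suc r → ℤ.∣ a ∣ ≤ suc n → suc r < suc n
  remainder<fuel x a x%a≡ ∣a∣≤ = ℕₚ.<-≤-trans (subst (ℕ._< ℤ.∣ a ∣) x%a≡ (n%d<d x a)) ∣a∣≤

  reduce-col : ∀ {n r} → SmithBelow n → ∀ a b c d .{{_ : NonZero a}} →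
               b % a ≡ suc r → ℤ.∣ a ∣ ≤ suc n → SmithForm (mat a b c d)
  reduce-col recurse a b c d b%a≡ ∣a∣≤ = descend recurse
    (∼-trans (add-col a b c d (- (b / a))) (rotate-cols a _ c _))
    (trans (remainder b a) (cong +_ b%a≡)) (remainder<fuel b a b%a≡ ∣a∣≤)

  reduce-row : ∀ {n r} → SmithBelow n → ∀ a b c d .{{_ : NonZero a}} →
               c % a ≡ suc r → ℤ.∣ a ∣ ≤ suc n → SmithForm (mat a b c d)
  reduce-row recurse a b c d c%a≡ ∣a∣≤ = descend recurse
    (∼-trans (add-row a b c d (- (c / a))) (rotate-rows a b _ _))
    (trans (remainder c a) (cong +_ c%a≡)) (remainder<fuel c a c%a≡ ∣a∣≤)

  divisible : ∀ x a .{{_ : NonZero a}} → x % a ≡ 0 → a ∣ x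
  divisible x a x%a≡0 = divides (x / a)
    (trans (a≡a%n+[a/n]*n x a) (trans (cong (λ r → + r + (x / a) * a) x%a≡0) (ℤₚ.+-identityˡ _)))

  diagonal : ∀ {n} → SmithBelow n → ∀ a d .{{_ : NonZero a}} → ℤ.∣ a ∣ ≤ suc n →
             SmithForm (mat a (+ 0) (+ 0) d)
  diagonal recurse a d ∣a∣≤ with d % a in d%a≡
  ... | zero  = smithForm a d (∼-refl _) (divisible d a d%a≡)
  ... | suc r = SmithForm-∼ (∼-≡ (add-row↑ a (+ 0) (+ 0) d (+ 1))
                                 (mat-≡ (ℤₚ.+-identityʳ a) (trans (ℤₚ.+-identityˡ _) (ℤₚ.*-identityˡ d)) refl refl))
                            (reduce-col recurse a d (+ 0) d d%a≡ ∣a∣≤)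

  clear : ∀ {n} → SmithBelow n → ∀ a b c d .{{_ : NonZero a}} →
          b % a ≡ 0 → c % a ≡ 0 → ℤ.∣ a ∣ ≤ suc n → SmithForm (mat a b c d)
  clear recurse a b c d b%a≡0 c%a≡0 ∣a∣≤ =
    SmithForm-∼ (∼-trans row-cleared col-cleared) (diagonal recurse a d′ ∣a∣≤)
    where
    d′ : ℤ
    d′ = d + - (c / a) * b
    row-cleared : mat a b c d ∼ mat a b (+ 0) d′
    row-cleared = ∼-≡ (add-row a b c d (- (c / a)))
      (mat-≡ refl refl (trans (remainder c a) (cong +_ c%a≡0)) refl)
    col-cleared : mat a b (+ 0) d′ ∼ mat a (+ 0) (+ 0) d′
    col-cleared = ∼-≡ (add-col a b (+ 0) d′ (- (b / a)))
      (mat-≡ refl (trans (remainder b a) (cong +_ b%a≡0)) refl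
             (trans (cong (λ x → d′ + x) (ℤₚ.*-zeroʳ (- (b / a)))) (ℤₚ.+-identityʳ d′)))

  smith-corner : ∀ {n} → SmithBelow n → ∀ a b c d .{{_ : NonZero a}} →
                 ℤ.∣ a ∣ ≤ suc n → SmithForm (mat a b c d)
  smith-corner recurse a b c d ∣a∣≤ with c % a in c%a≡ | b % a in b%a≡
  ... | suc r | _     = reduce-row recurse a b c d c%a≡ ∣a∣≤
  ... | zero  | suc r = reduce-col recurse a b c d b%a≡ ∣a∣≤
  ... | zero  | zero  = clear recurse a b c d b%a≡ c%a≡ ∣a∣≤

  smith-fuel : ∀ n → SmithBelow n
  smith-fuel zero    R a≢0 ∣a∣≤0 = ⊥-elim (a≢0 (ℤₚ.∣i∣≡0⇒i≡0 (ℕₚ.n≤0⇒n≡0 ∣a∣≤0)))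
  smith-fuel (suc n) (mat a b c d) a≢0 ∣a∣≤ =
    smith-corner (smith-fuel n) a b c d {{ℤ.≢-nonZero a≢0}} ∣a∣≤

smith : ∀ R → Mat₂.a R ≢ + 0 → SmithForm R
smith R a≢0 = smith-fuel _ R a≢0 ℕₚ.≤-refl

module SmithForm-properties {R : Mat₂} (S : SmithForm R) where
  open SmithForm S
  private module E = _∼_ equivalent

  product≡det : e * f ≡ det R
  product≡det = trans (sym (diagonal-det e f)) E.det≡
    where
    diagonal-det : ∀ e f → e * f - + 0 * + 0 ≡ e * f
    diagonal-det = solve-∀

  e∣ᴹ : e ∣ᴹ R
  e∣ᴹ = E.divisors⁻ (∣-refl , divides (+ 0) refl , divides (+ 0) refl , e∣f)

  ∣ᴹ⇒∣e : ∀ {m} → m ∣ᴹ R → m ∣ e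
  ∣ᴹ⇒∣e m∣R = proj₁ (E.divisors m∣R)

-- Cyclic groups

module _ {m : ℕ} where
  open RawGroup (ZMod m)

  ZMod-≈ : ∀ x y q → x - y ≡ q * + m → x ≈ y
  ZMod-≈ x y q x-y≡qm = ∣⇒∣ᵤ (divides q x-y≡qm)

  ZMod-quotient : ∀ x y → x ≈ y → ∃ λ q → x - y ≡ q * + m
  ZMod-quotient x y x≈y with ∣ᵤ⇒∣ {+ m} {x - y} x≈y
  ... | divides q x-y≡qm = q , x-y≡qm

  ZMod-refl : ∀ x → x ≈ x
  ZMod-refl x = ZMod-≈ x x (+ 0) (cancel x (+ m))
    where
    cancel : ∀ x m → x - x ≡ + 0 * m
    cancel = solve-∀

  ZMod-sym : ∀ {x y} → x ≈ y → y ≈ x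
  ZMod-sym {x} {y} x≈y with ZMod-quotient x y x≈y
  ... | q , x-y≡qm =
    ZMod-≈ y x (- q) (trans (flip x y) (trans (cong -_ x-y≡qm) (ℤₚ.neg-distribˡ-* q (+ m))))
    where
    flip : ∀ x y → y - x ≡ - (x - y)
    flip = solve-∀

  ZMod-trans : Transitive _≈_
  ZMod-trans {x} {y} {z} x≈y y≈z with ZMod-quotient x y x≈y | ZMod-quotient y z y≈z
  ... | q , x-y≡qm | r , y-z≡rm = ZMod-≈ x z (q + r)
    (trans (telescope x y z) (trans (cong₂ _+_ x-y≡qm y-z≡rm) (sym (ℤₚ.*-distribʳ-+ (+ m) q r))))
    where
    telescope : ∀ x y z → x - z ≡ (x - y) + (y - z)
    telescope = solve-∀

  ZMod-+ : ∀ {x x′ y y′} → x ≈ x′ → y ≈ y′ → x + y ≈ x′ + y′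
  ZMod-+ {x} {x′} {y} {y′} x≈x′ y≈y′ with ZMod-quotient x x′ x≈x′ | ZMod-quotient y y′ y≈y′
  ... | q , x-x′≡qm | r , y-y′≡rm = ZMod-≈ (x + y) (x′ + y′) (q + r)
    (trans (regroup x x′ y y′) (trans (cong₂ _+_ x-x′≡qm y-y′≡rm) (sym (ℤₚ.*-distribʳ-+ (+ m) q r))))
    where
    regroup : ∀ x x′ y y′ → x + y - (x′ + y′) ≡ (x - x′) + (y - y′)
    regroup = solve-∀

  ZMod-neg : ∀ {x x′} → x ≈ x′ → - x ≈ - x′
  ZMod-neg {x} {x′} x≈x′ with ZMod-quotient x x′ x≈x′
  ... | q , x-x′≡qm = ZMod-≈ (- x) (- x′) (- q)
    (trans (negate x x′) (trans (cong -_ x-x′≡qm) (ℤₚ.neg-distribˡ-* q (+ m))))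
    where
    negate : ∀ x x′ → - x - - x′ ≡ - (x - x′)
    negate = solve-∀

ZMod×-trans : ∀ {m n} → Transitive (RawGroup._≈_ (ZMod m ×G ZMod n))
ZMod×-trans {i = x₁ , x₂} {y₁ , y₂} {z₁ , z₂} (x₁≈y₁ , x₂≈y₂) (y₁≈z₁ , y₂≈z₂) =
  ZMod-trans {i = x₁} {y₁} {z₁} x₁≈y₁ y₁≈z₁ , ZMod-trans {i = x₂} {y₂} {z₂} x₂≈y₂ y₂≈z₂

Coker₂-diagonal : ∀ e f → Coker₂ (mat e (+ 0) (+ 0) f) ≅ (ZMod ℤ.∣ e ∣ ×G ZMod ℤ.∣ f ∣)
Coker₂-diagonal e f = isomorphism {Coker₂ (mat e (+ 0) (+ 0) f)} {ZMod ℤ.∣ e ∣ ×G ZMod ℤ.∣ f ∣}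
  (λ x → x) (λ {x} {y} → to {x} {y})
  (λ x y → ZMod-refl (proj₁ x + proj₁ y) , ZMod-refl (proj₂ x + proj₂ y))
  (ZMod-refl (+ 0) , ZMod-refl (+ 0))
  (λ x → ZMod-refl (- proj₁ x) , ZMod-refl (- proj₂ x))
  (λ {x} {y} → from {x} {y}) (λ y → y , λ {z} → to {z} {y})
  where
  first : ∀ e f w₁ w₂ → e * w₁ + + 0 * w₂ ≡ w₁ * e
  first = solve-∀
  second : ∀ e f w₁ w₂ → + 0 * w₁ + f * w₂ ≡ w₂ * f
  second = solve-∀
  to : ∀ {x y} → RawGroup._≈_ (Coker₂ (mat e (+ 0) (+ 0) f)) x y →
       RawGroup._≈_ (ZMod ℤ.∣ e ∣ ×G ZMod ℤ.∣ f ∣) x y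
  to ((w₁ , w₂) , x-y≡Dw) =
    ∣⇒∣ᵤ (divides w₁ (trans (cong proj₁ x-y≡Dw) (first e f w₁ w₂))) ,
    ∣⇒∣ᵤ (divides w₂ (trans (cong proj₂ x-y≡Dw) (second e f w₁ w₂)))
  from : ∀ {x y} → RawGroup._≈_ (ZMod ℤ.∣ e ∣ ×G ZMod ℤ.∣ f ∣) x y →
         RawGroup._≈_ (Coker₂ (mat e (+ 0) (+ 0) f)) x y
  from {x₁ , x₂} {y₁ , y₂} (e∣x₁-y₁ , f∣x₂-y₂)
    with ∣ᵤ⇒∣ {e} {x₁ - y₁} e∣x₁-y₁ | ∣ᵤ⇒∣ {f} {x₂ - y₂} f∣x₂-y₂
  ... | divides q₁ x₁-y₁≡ | divides q₂ x₂-y₂≡ = (q₁ , q₂) ,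
    cong₂ _,_ (trans x₁-y₁≡ (sym (first e f q₁ q₂))) (trans x₂-y₂≡ (sym (second e f q₁ q₂)))

ZMod-one-× : ∀ m → (ZMod 1 ×G ZMod m) ≅ ZMod m
ZMod-one-× m = isomorphism {ZMod 1 ×G ZMod m} {ZMod m} proj₂ proj₂
  (λ x y → ZMod-refl (proj₂ x + proj₂ y)) (ZMod-refl (+ 0)) (λ x → ZMod-refl (- proj₂ x))
  (λ x≈y → ℕᵈ.1∣ _ , x≈y) (λ y → (+ 0 , y) , proj₂)

-- The generator is a preimage of 1, and x is the power of it given by the representative f x.
Cyclic-≅ZMod : ∀ {G m} → (∀ x → RawGroup._≈_ G x x) → G ≅ ZMod m → Cyclic G
Cyclic-≅ZMod {G} {m} G-refl (f , f-iso) = g , λ x →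
  f x , injective (ZMod-sym {x = f (_^ℤ_ G g (f x))} {y = f x} (power≈ (f x)))
  where
  module G = RawGroup G
  open GroupMorphisms.IsGroupIsomorphism f-iso
  g : G.Carrier
  g = proj₁ (surjective (+ 1))
  fg≈1 : RawGroup._≈_ (ZMod m) (f g) (+ 1)
  fg≈1 = proj₂ (surjective (+ 1)) (G-refl g)
  powerℕ≈ : ∀ n → RawGroup._≈_ (ZMod m) (f (_^ℕ_ G g n)) (+ n)
  powerℕ≈ zero    = ε-homo
  powerℕ≈ (suc n) = ZMod-trans {i = f (_^ℕ_ G g (suc n))} {j = f g + f (_^ℕ_ G g n)}
    (∙-homo g (_^ℕ_ G g n)) (ZMod-+ {x = f g} {y = f (_^ℕ_ G g n)} fg≈1 (powerℕ≈ n))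
  power≈ : ∀ n → RawGroup._≈_ (ZMod m) (f (_^ℤ_ G g n)) n
  power≈ (+ n)    = powerℕ≈ n
  power≈ -[1+ n ] = ZMod-trans {i = f (_^ℤ_ G g -[1+ n ])} {j = - f (_^ℕ_ G g (suc n))} {k = -[1+ n ]}
    (⁻¹-homo (_^ℕ_ G g (suc n))) (ZMod-neg {x = f (_^ℕ_ G g (suc n))} {x′ = + suc n} (powerℕ≈ (suc n)))

-- Second-order linear recurrences

module Recurrence (α β : ℤ) where

  seq : ℤ → ℤ → ℕ → ℤ
  seq s₀ s₁ zero          = s₀
  seq s₀ s₁ (suc zero)    = s₁
  seq s₀ s₁ (suc (suc n)) = α * seq s₀ s₁ (suc n) - β * seq s₀ s₁ n

  seq-split : ∀ s₀ s₁ n → seq s₀ s₁ n ≡ s₀ * seq (+ 1) (+ 0) n + s₁ * seq (+ 0) (+ 1) n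
  seq-split s₀ s₁ zero          = basis₀ s₀ s₁
    where
    basis₀ : ∀ s₀ s₁ → s₀ ≡ s₀ * + 1 + s₁ * + 0
    basis₀ = solve-∀
  seq-split s₀ s₁ (suc zero)    = basis₁ s₀ s₁
    where
    basis₁ : ∀ s₀ s₁ → s₁ ≡ s₀ * + 0 + s₁ * + 1
    basis₁ = solve-∀
  seq-split s₀ s₁ (suc (suc n)) =
    trans (cong₂ (λ x y → α * x - β * y) (seq-split s₀ s₁ (suc n)) (seq-split s₀ s₁ n))
          (combine s₀ s₁ α β (seq (+ 1) (+ 0) (suc n)) (seq (+ 0) (+ 1) (suc n))
                             (seq (+ 1) (+ 0) n) (seq (+ 0) (+ 1) n))
    where
    combine : ∀ s₀ s₁ α β a₁ b₁ a₀ b₀ →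
      α * (s₀ * a₁ + s₁ * b₁) - β * (s₀ * a₀ + s₁ * b₀) ≡ s₀ * (α * a₁ - β * a₀) + s₁ * (α * b₁ - β * b₀)
    combine = solve-∀

  -- back N b a x is the solution y of y m = α y (m+1) - β y (m+2) - x m (m < N)
  -- with final values y N = b, y (N+1) = a, computed from the top down.
  back : ℕ → ℤ → ℤ → (ℕ → ℤ) → ℕ → ℤ
  back zero    b a x zero          = b
  back zero    b a x (suc zero)    = a
  back zero    b a x (suc (suc i)) = + 0
  back (suc N) b a x zero    =
    α * back N b a (λ m → x (suc m)) 0 - β * back N b a (λ m → x (suc m)) 1 - x 0
  back (suc N) b a x (suc i) = back N b a (λ m → x (suc m)) i

  back-top : ∀ N b a x → back N b a x N ≡ b
  back-top zero    b a x = refl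
  back-top (suc N) b a x = back-top N b a (λ m → x (suc m))

  back-top₊₁ : ∀ N b a x → back N b a x (suc N) ≡ a
  back-top₊₁ zero    b a x = refl
  back-top₊₁ (suc N) b a x = back-top₊₁ N b a (λ m → x (suc m))

  back-rec : ∀ N b a x {m} → m < N →
             back N b a x m ≡ α * back N b a x (suc m) - β * back N b a x (suc (suc m)) - x m
  back-rec (suc N) b a x {zero}  _         = refl
  back-rec (suc N) b a x {suc m} (s≤s m<N) = back-rec N b a (λ m → x (suc m)) m<N

  back-unique : ∀ N b a x (y : ℕ → ℤ) → y N ≡ b → y (suc N) ≡ a →
                (∀ m → m < N → y m ≡ α * y (suc m) - β * y (suc (suc m)) - x m) →
                ∀ i → i ≤ suc N → y i ≡ back N b a x i
  back-unique zero    b a x y yN≡b _     _   zero          _ = yN≡b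
  back-unique zero    b a x y _    yN₁≡a _   (suc zero)    _ = yN₁≡a
  back-unique zero    b a x y _    _     _   (suc (suc i)) (s≤s ())
  back-unique (suc N) b a x y yN≡b yN₁≡a rec zero          _ = begin
    y 0                                                    ≡⟨ rec 0 (s≤s z≤n) ⟩
    α * y 1 - β * y 2 - x 0                                ≡⟨ cong₂ (λ u v → α * u - β * v - x 0)
                                                                (above 0 z≤n) (above 1 (s≤s z≤n)) ⟩
    α * back N b a x′ 0 - β * back N b a x′ 1 - x 0        ∎
    where
    open ≡-Reasoning
    x′ : ℕ → ℤ
    x′ m = x (suc m)
    above : ∀ i → i ≤ suc N → y (suc i) ≡ back N b a x′ i
    above = back-unique N b a x′ (λ i → y (suc i)) yN≡b yN₁≡a (λ m m<N → rec (suc m) (s≤s m<N))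
  back-unique (suc N) b a x y yN≡b yN₁≡a rec (suc i) (s≤s i≤N) =
    back-unique N b a (λ m → x (suc m)) (λ i → y (suc i)) yN≡b yN₁≡a
      (λ m m<N → rec (suc m) (s≤s m<N)) i i≤N

  back-cong : ∀ N {b b′ a a′ x x′} → b ≡ b′ → a ≡ a′ → (∀ m → x m ≡ x′ m) →
              ∀ i → back N b a x i ≡ back N b′ a′ x′ i
  back-cong zero    refl refl x≡x′ zero          = refl
  back-cong zero    refl refl x≡x′ (suc zero)    = refl
  back-cong zero    refl refl x≡x′ (suc (suc i)) = refl
  back-cong (suc N) b≡b′ a≡a′ x≡x′ zero = cong₂ _-_
    (cong₂ (λ u v → α * u - β * v) (back-cong N b≡b′ a≡a′ (λ m → x≡x′ (suc m)) 0)
                                   (back-cong N b≡b′ a≡a′ (λ m → x≡x′ (suc m)) 1))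
    (x≡x′ 0)
  back-cong (suc N) b≡b′ a≡a′ x≡x′ (suc i) = back-cong N b≡b′ a≡a′ (λ m → x≡x′ (suc m)) i

  back-+ : ∀ N b a x b′ a′ x′ i →
           back N (b + b′) (a + a′) (λ m → x m + x′ m) i ≡ back N b a x i + back N b′ a′ x′ i
  back-+ zero    b a x b′ a′ x′ zero          = refl
  back-+ zero    b a x b′ a′ x′ (suc zero)    = refl
  back-+ zero    b a x b′ a′ x′ (suc (suc i)) = refl
  back-+ (suc N) b a x b′ a′ x′ zero =
    trans (cong₂ (λ u v → α * u - β * v - (x 0 + x′ 0)) (back-+ N b a y b′ a′ y′ 0) (back-+ N b a y b′ a′ y′ 1))
          (regroup α β (back N b a y 0) (back N b′ a′ y′ 0) (back N b a y 1) (back N b′ a′ y′ 1) (x 0) (x′ 0))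
    where
    y y′ : ℕ → ℤ
    y  m = x (suc m)
    y′ m = x′ (suc m)
    regroup : ∀ α β u u′ v v′ w w′ →
      α * (u + u′) - β * (v + v′) - (w + w′) ≡ (α * u - β * v - w) + (α * u′ - β * v′ - w′)
    regroup = solve-∀
  back-+ (suc N) b a x b′ a′ x′ (suc i) = back-+ N b a (λ m → x (suc m)) b′ a′ (λ m → x′ (suc m)) i

  back-split : ∀ N b a x i → back N b a x i ≡ back N (+ 0) (+ 0) x i + back N b a (λ _ → + 0) i
  back-split N b a x i = trans
    (back-cong N (sym (ℤₚ.+-identityˡ b)) (sym (ℤₚ.+-identityˡ a)) (λ m → sym (ℤₚ.+-identityʳ (x m))) i)
    (back-+ N (+ 0) (+ 0) x b a (λ _ → + 0) i)

  back-homogeneous : ∀ N b a → back N b a (λ _ → + 0) 0 ≡ seq a b (suc N)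
                             × back N b a (λ _ → + 0) 1 ≡ seq a b N
  back-homogeneous zero    b a = refl , refl
  back-homogeneous (suc N) b a with back-homogeneous N b a
  ... | y₀≡ , y₁≡ = trans (cong₂ (λ u v → α * u - β * v - + 0) y₀≡ y₁≡) (ℤₚ.+-identityʳ _) , y₀≡

  cassini : ∀ n → seq (+ 0) (+ 1) (suc n) * seq (+ 0) (+ 1) (suc n)
                  - seq (+ 0) (+ 1) n * seq (+ 0) (+ 1) (suc (suc n)) ≡ β ℤ.^ n
  cassini zero    = base α β
    where
    base : ∀ α β → + 1 * + 1 - + 0 * (α * + 1 - β * + 0) ≡ + 1
    base = solve-∀
  cassini (suc n) = trans (shift α β (seq (+ 0) (+ 1) n) (seq (+ 0) (+ 1) (suc n)))
                          (cong (β *_) (cassini n))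
    where
    shift : ∀ α β b₀ b₁ →
      (α * b₁ - β * b₀) * (α * b₁ - β * b₀) - b₁ * (α * (α * b₁ - β * b₀) - β * b₁)
        ≡ β * (b₁ * b₁ - b₀ * (α * b₁ - β * b₀))
    shift = solve-∀

-- The reduced Laplacian of the wheel

module Wheel (q t k′ : ℕ) where

  k : ℕ
  k = suc k′

  L : Fin (suc k) → Fin (suc k) → ℤ
  L = redLap q t k

  D : ℤ
  D = + (t ℕ.+ 1 ℕ.+ q)

  deg : ℕ → ℕ
  deg i = (if ⌊ i ℕ.≟ 0 ⌋ then 0 else t) ℕ.+ 1 ℕ.+ q

  -- index i stands for the rim vertex v_{i+1}; prev i and next i index its rim neighbours
  prev next : ℕ → ℕ
  prev i = (i ℕ.+ k) ℕ.% suc k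
  next i = (i ℕ.+ 1) ℕ.% suc k

  prev-zero : prev 0 ≡ k
  prev-zero = m≤n⇒m%n≡m ℕₚ.≤-refl

  prev-suc : ∀ {i} → i < k → prev (suc i) ≡ i
  prev-suc {i} i<k = begin
    (suc i ℕ.+ k) ℕ.% suc k  ≡⟨ cong (ℕ._% suc k) (ℕₚ.+-suc i k) ⟨
    (i ℕ.+ suc k) ℕ.% suc k  ≡⟨ [m+n]%n≡m%n i (suc k) ⟩
    i ℕ.% suc k            ≡⟨ m≤n⇒m%n≡m (ℕₚ.<⇒≤ i<k) ⟩
    i                      ∎
    where open ≡-Reasoning

  next-< : ∀ {i} → i < k → next i ≡ suc i
  next-< {i} i<k = trans (cong (ℕ._% suc k) (ℕₚ.+-comm i 1)) (m≤n⇒m%n≡m i<k)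

  next-k : next k ≡ 0
  next-k = trans (cong (ℕ._% suc k) (ℕₚ.+-comm k 1)) (n%n≡0 (suc k))

  prev≢ : ∀ {i} → i < suc k → prev i ≢ i
  prev≢ {zero}  _           prev≡ = ℕₚ.1+n≢0 (trans (sym prev-zero) prev≡)
  prev≢ {suc i} (s≤s i<k) prev≡ = ℕₚ.1+n≢n (sym (trans (sym (prev-suc i<k)) prev≡))

  next≢ : ∀ {i} → i < suc k → next i ≢ i
  next≢ {i} i<1+k next≡ with ℕₚ.m≤n⇒m<n∨m≡n (ℕ.s≤s⁻¹ i<1+k)
  ... | inj₁ i<k  = ℕₚ.1+n≢n (trans (sym (next-< i<k)) next≡)
  ... | inj₂ refl = ℕₚ.1+n≢0 (sym (trans (sym next-k) next≡))

  L-entry : ∀ i j → L i j ≡ pick (toℕ j) (toℕ i) (+ deg (toℕ i))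
                          + pick (toℕ j) (prev (toℕ i)) (- + 1)
                          + pick (toℕ j) (next (toℕ i)) (- + q)
  L-entry i j with toℕ i ℕ.≟ toℕ j | toℕ j ℕ.≟ toℕ i | toℕ j ℕ.≟ prev (toℕ i) | toℕ j ℕ.≟ next (toℕ i)
  ... | yes _ | yes _   | no _     | no _     = sym (trans (ℤₚ.+-identityʳ _) (ℤₚ.+-identityʳ _))
  ... | yes i≡j | _     | yes j≡p  | _       = ⊥-elim (prev≢ (toℕ<n i) (trans (sym j≡p) (sym i≡j)))
  ... | yes i≡j | _     | _        | yes j≡n = ⊥-elim (next≢ (toℕ<n i) (trans (sym j≡n) (sym i≡j)))
  ... | yes i≡j | no j≢i | _       | _       = ⊥-elim (j≢i (sym i≡j))
  ... | no i≢j  | yes j≡i | _      | _       = ⊥-elim (i≢j (sym j≡i))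
  ... | no _    | no _  | yes _    | yes _    = trans (cong -_ (ℤₚ.pos-+ 1 q)) (ℤₚ.neg-distrib-+ (+ 1) (+ q))
  ... | no _    | no _  | yes _    | no _     = sym (ℤₚ.+-identityʳ _)
  ... | no _    | no _  | no _     | yes _    = sym (ℤₚ.+-identityˡ _)
  ... | no _    | no _  | no _     | no _     = refl

  lap : (ℕ → ℤ) → ℕ → ℤ
  lap f i = + deg i * f i - f (prev i) - + q * f (next i)

  L-row : ∀ z i → (L ·ᴹ z) i ≡ lap (at z) (toℕ i)
  L-row z i = begin
    Σℤ (suc k) (λ j → L i j * z j)
      ≡⟨ Σℤ-cong (suc k) (λ j → trans (cong (_* z j) (L-entry i j))
                                       (distrib (self j) (left j) (right j) (z j))) ⟩
    Σℤ (suc k) (λ j → self j * z j + left j * z j + right j * z j)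
      ≡⟨ Σℤ-+ (suc k) (λ j → self j * z j + left j * z j) (λ j → right j * z j) ⟩
    Σℤ (suc k) (λ j → self j * z j + left j * z j) + Σℤ (suc k) (λ j → right j * z j)
      ≡⟨ cong (_+ Σℤ (suc k) (λ j → right j * z j))
              (Σℤ-+ (suc k) (λ j → self j * z j) (λ j → left j * z j)) ⟩
    Σℤ (suc k) (λ j → self j * z j) + Σℤ (suc k) (λ j → left j * z j) + Σℤ (suc k) (λ j → right j * z j)
      ≡⟨ cong₂ _+_ (cong₂ _+_ (Σℤ-pick (suc k) z i′ _) (Σℤ-pick (suc k) z (prev i′) _))
                   (Σℤ-pick (suc k) z (next i′) _) ⟩
    + deg i′ * at z i′ + - + 1 * at z (prev i′) + - + q * at z (next i′)
      ≡⟨ normalise (+ deg i′) (+ q) (at z i′) (at z (prev i′)) (at z (next i′)) ⟩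
    lap (at z) i′ ∎
    where
    open ≡-Reasoning
    i′ : ℕ
    i′ = toℕ i
    self left right : Fin (suc k) → ℤ
    self  j = pick (toℕ j) i′ (+ deg i′)
    left  j = pick (toℕ j) (prev i′) (- + 1)
    right j = pick (toℕ j) (next i′) (- + q)
    distrib : ∀ a b c x → (a + b + c) * x ≡ a * x + b * x + c * x
    distrib = solve-∀
    normalise : ∀ d q x y w → d * x + - + 1 * y + - q * w ≡ d * x - y - q * w
    normalise = solve-∀

  L-rowℕ : ∀ z {i} → i < suc k → at (L ·ᴹ z) i ≡ lap (at z) i
  L-rowℕ z {i} i<1+k = begin
    at (L ·ᴹ z) i          ≡⟨ cong (at (L ·ᴹ z)) (toℕ-fromℕ< i<1+k) ⟨
    at (L ·ᴹ z) (toℕ j)    ≡⟨ at-toℕ (L ·ᴹ z) j ⟩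
    (L ·ᴹ z) j             ≡⟨ L-row z j ⟩
    lap (at z) (toℕ j)     ≡⟨ cong (lap (at z)) (toℕ-fromℕ< i<1+k) ⟩
    lap (at z) i           ∎
    where
    open ≡-Reasoning
    j : Fin (suc k)
    j = fromℕ< i<1+k

  -- the entries along the rim starting at v₂, wrapping around to v₁
  rim : (Fin (suc k) → ℤ) → ℕ → ℤ
  rim z j = at z (next j)

  rim-< : ∀ z {j} → j < k → rim z j ≡ at z (suc j)
  rim-< z j<k = cong (at z) (next-< j<k)

  rim-k : ∀ z → rim z k ≡ at z 0
  rim-k z = cong (at z) next-k

  row₀ : ∀ z → at (L ·ᴹ z) 0 ≡ + suc q * at z 0 - rim z k′ - + q * rim z 0
  row₀ z = trans (L-rowℕ z (s≤s z≤n))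
    (cong (λ w → + suc q * at z 0 - w - + q * rim z 0) (trans (cong (at z) prev-zero) (sym (rim-< z ℕₚ.≤-refl))))

  row₁ : ∀ z → at (L ·ᴹ z) 1 ≡ D * rim z 0 - at z 0 - + q * rim z 1
  row₁ z = trans (L-rowℕ z (s≤s (s≤s z≤n)))
    (cong₂ (λ u v → D * u - at z v - + q * rim z 1) (sym (rim-< z (s≤s z≤n))) (prev-suc (s≤s z≤n)))

  row₂₊ : ∀ z {m} → m < k′ → at (L ·ᴹ z) (suc (suc m)) ≡ D * rim z (suc m) - rim z m - + q * rim z (suc (suc m))
  row₂₊ z {m} m<k′ = trans (L-rowℕ z (s≤s (s≤s m<k′)))
    (cong₂ (λ u v → D * u - v - + q * rim z (suc (suc m)))
      (sym (rim-< z (s≤s m<k′))) (trans (cong (at z) (prev-suc (s≤s m<k′))) (sym (rim-< z (ℕₚ.m<n⇒m<1+n m<k′)))))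

-- Reduction to a 2 × 2 relation matrix

module Reduction (q t k′ : ℕ) where
  open Wheel q t k′
  open Recurrence D (+ q)

  inner : (Fin (suc k) → ℤ) → ℕ → ℤ
  inner x m = at x (suc (suc m))

  rim-back : ∀ u i → i ≤ suc k′ → rim u i ≡ back k′ (at u k) (at u 0) (inner (L ·ᴹ u)) i
  rim-back u = back-unique k′ (at u k) (at u 0) (inner (L ·ᴹ u)) (rim u)
    (rim-< u ℕₚ.≤-refl) (rim-k u) (λ m m<k′ → isolate (row₂₊ u m<k′))
    where
    isolate : ∀ {x a b c} → x ≡ D * a - b - + q * c → b ≡ D * a - + q * c - x
    isolate {x} {a} {b} {c} x≡ = trans (rearrange D a b (+ q) c) (cong (λ y → D * a - + q * c - y) (sym x≡))
      where
      rearrange : ∀ d a b q c → b ≡ d * a - q * c - (d * a - b - q * c)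
      rearrange = solve-∀

  σ : (Fin (suc k) → ℤ) → ℕ → ℤ
  σ x = back k′ (+ 0) (+ 0) (inner x)

  -- φ x is x - L y on the rows of v₁ and v₂, where y is the vector vanishing
  -- at v₁ and v_{k+1} that matches x on all other rows; its rim values are σ x.
  φ : (Fin (suc k) → ℤ) → ℤ²
  φ x = (at x 0 + + q * σ x 0 , at x 1 - D * σ x 0 + + q * σ x 1)

  φ-cong : ∀ {x y} → (∀ i → x i ≡ y i) → φ x ≡ φ y
  φ-cong {x} {y} x≡y = cong₂ _,_
    (cong₂ (λ a s → a + + q * s) (at-cong x≡y 0) (σ≡ 0))
    (cong₂ (λ a s → a - D * proj₁ s + + q * proj₂ s) (at-cong x≡y 1) (cong₂ _,_ (σ≡ 0) (σ≡ 1)))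
    where
    σ≡ : ∀ i → σ x i ≡ σ y i
    σ≡ = back-cong k′ refl refl (λ m → at-cong x≡y (suc (suc m)))

  φ-+ : ∀ x y → φ (λ i → x i + y i) ≡ φ x +² φ y
  φ-+ x y = cong₂ _,_
    (trans (cong₂ (λ a s → a + + q * s) (at-+ x y 0) (σ-+ 0))
           (first (+ q) (at x 0) (at y 0) (σ x 0) (σ y 0)))
    (trans (cong₂ (λ a s → a - D * proj₁ s + + q * proj₂ s) (at-+ x y 1) (cong₂ _,_ (σ-+ 0) (σ-+ 1)))
           (second D (+ q) (at x 1) (at y 1) (σ x 0) (σ y 0) (σ x 1) (σ y 1)))
    where
    σ-+ : ∀ i → σ (λ i → x i + y i) i ≡ σ x i + σ y i
    σ-+ i = trans (back-cong k′ refl refl (λ m → at-+ x y (suc (suc m))) i)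
                  (back-+ k′ (+ 0) (+ 0) (inner x) (+ 0) (+ 0) (inner y) i)
    first : ∀ q a b s s′ → a + b + q * (s + s′) ≡ (a + q * s) + (b + q * s′)
    first = solve-∀
    second : ∀ d q a b s s′ r r′ →
      a + b - d * (s + s′) + q * (r + r′) ≡ (a - d * s + q * r) + (b - d * s′ + q * r′)
    second = solve-∀

  A B : ℕ → ℤ
  A = seq (+ 1) (+ 0)
  B = seq (+ 0) (+ 1)

  R : Mat₂
  R = mat (+ suc q - + q * A k) (- + 1 - + q * B k) (D * A k - + 1 - + q * A k′) (D * B k - + q * B k′)

  homogeneous₀ : ∀ b a → back k′ b a (λ _ → + 0) 0 ≡ a * A k + b * B k
  homogeneous₀ b a = trans (proj₁ (back-homogeneous k′ b a)) (seq-split a b k)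

  homogeneous₁ : ∀ b a → back k′ b a (λ _ → + 0) 1 ≡ a * A k′ + b * B k′
  homogeneous₁ b a = trans (proj₂ (back-homogeneous k′ b a)) (seq-split a b k′)

  φ-L : ∀ u → φ (L ·ᴹ u) ≡ R · (at u 0 , at u k)
  φ-L u = cong₂ _,_
    (begin
      at (L ·ᴹ u) 0 + + q * s₀
        ≡⟨ cong (_+ + q * s₀) (row₀ u) ⟩
      + suc q * u₀ - rim u k′ - + q * rim u 0 + + q * s₀
        ≡⟨ cong₂ (λ r r₀ → + suc q * u₀ - r - + q * r₀ + + q * s₀) (rim-< u ℕₚ.≤-refl) rim₀ ⟩
      + suc q * u₀ - uₖ - + q * (s₀ + (u₀ * A k + uₖ * B k)) + + q * s₀
        ≡⟨ first (+ suc q) (+ q) u₀ uₖ s₀ (A k) (B k) ⟩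
      (+ suc q - + q * A k) * u₀ + (- + 1 - + q * B k) * uₖ ∎)
    (begin
      at (L ·ᴹ u) 1 - D * s₀ + + q * s₁
        ≡⟨ cong (λ r → r - D * s₀ + + q * s₁) (row₁ u) ⟩
      D * rim u 0 - u₀ - + q * rim u 1 - D * s₀ + + q * s₁
        ≡⟨ cong₂ (λ r₀ r₁ → D * r₀ - u₀ - + q * r₁ - D * s₀ + + q * s₁) rim₀ rim₁ ⟩
      D * (s₀ + (u₀ * A k + uₖ * B k)) - u₀ - + q * (s₁ + (u₀ * A k′ + uₖ * B k′)) - D * s₀ + + q * s₁
        ≡⟨ second D (+ q) u₀ uₖ s₀ s₁ (A k) (B k) (A k′) (B k′) ⟩
      (D * A k - + 1 - + q * A k′) * u₀ + (D * B k - + q * B k′) * uₖ ∎)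
    where
    open ≡-Reasoning
    u₀ uₖ s₀ s₁ : ℤ
    u₀ = at u 0
    uₖ = at u k
    s₀ = σ (L ·ᴹ u) 0
    s₁ = σ (L ·ᴹ u) 1
    rim₀ : rim u 0 ≡ s₀ + (u₀ * A k + uₖ * B k)
    rim₀ = trans (rim-back u 0 z≤n)
      (trans (back-split k′ uₖ u₀ (inner (L ·ᴹ u)) 0) (cong (λ h → s₀ + h) (homogeneous₀ uₖ u₀)))
    rim₁ : rim u 1 ≡ s₁ + (u₀ * A k′ + uₖ * B k′)
    rim₁ = trans (rim-back u 1 (s≤s z≤n))
      (trans (back-split k′ uₖ u₀ (inner (L ·ᴹ u)) 1) (cong (λ h → s₁ + h) (homogeneous₁ uₖ u₀)))
    first : ∀ s q u₀ uₖ σ a b →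
      s * u₀ - uₖ - q * (σ + (u₀ * a + uₖ * b)) + q * σ ≡ (s - q * a) * u₀ + (- + 1 - q * b) * uₖ
    first = solve-∀
    second : ∀ d q u₀ uₖ σ₀ σ₁ a b a′ b′ →
      d * (σ₀ + (u₀ * a + uₖ * b)) - u₀ - q * (σ₁ + (u₀ * a′ + uₖ * b′)) - d * σ₀ + q * σ₁
        ≡ (d * a - + 1 - q * a′) * u₀ + (d * b - q * b′) * uₖ
    second = solve-∀

  extend : ℤ → (ℕ → ℤ) → ℕ → ℤ
  extend z₀ τ zero    = z₀
  extend z₀ τ (suc j) = τ j

  vec : ℤ → (ℕ → ℤ) → Fin (suc k) → ℤ
  vec z₀ τ i = extend z₀ τ (toℕ i)

  rim-vec : ∀ z₀ τ → τ (suc k′) ≡ z₀ → ∀ j → j ≤ suc k′ → rim (vec z₀ τ) j ≡ τ j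
  rim-vec z₀ τ τ-top j j≤k with ℕₚ.m≤n⇒m<n∨m≡n j≤k
  ... | inj₁ j<k  = trans (rim-< (vec z₀ τ) j<k) (at-tabulate (extend z₀ τ) (s≤s j<k))
  ... | inj₂ refl = trans (rim-k (vec z₀ τ)) (sym τ-top)

  module Kernel (d : Fin (suc k) → ℤ) (w₁ w₂ : ℤ) (φd≡Rw : φ d ≡ R · (w₁ , w₂)) where

    τ : ℕ → ℤ
    τ = back k′ w₂ w₁ (inner d)

    z : Fin (suc k) → ℤ
    z = vec w₁ τ

    rim≡τ : ∀ j → j ≤ suc k′ → rim z j ≡ τ j
    rim≡τ = rim-vec w₁ τ (back-top₊₁ k′ w₂ w₁ (inner d))

    τ₀ : τ 0 ≡ σ d 0 + (w₁ * A k + w₂ * B k)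
    τ₀ = trans (back-split k′ w₂ w₁ (inner d) 0) (cong (λ h → σ d 0 + h) (homogeneous₀ w₂ w₁))

    τ₁ : τ 1 ≡ σ d 1 + (w₁ * A k′ + w₂ * B k′)
    τ₁ = trans (back-split k′ w₂ w₁ (inner d) 1) (cong (λ h → σ d 1 + h) (homogeneous₁ w₂ w₁))

    row-v₁ : at (L ·ᴹ z) 0 ≡ at d 0
    row-v₁ = begin
      at (L ·ᴹ z) 0                                     ≡⟨ row₀ z ⟩
      + suc q * w₁ - rim z k′ - + q * rim z 0
        ≡⟨ cong₂ (λ r r₀ → + suc q * w₁ - r - + q * r₀)
                 (trans (rim≡τ k′ (ℕₚ.n≤1+n k′)) (back-top k′ w₂ w₁ (inner d))) (trans (rim≡τ 0 z≤n) τ₀) ⟩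
      + suc q * w₁ - w₂ - + q * (σ d 0 + (w₁ * A k + w₂ * B k))
        ≡⟨ solve (+ suc q) (+ q) w₁ w₂ (σ d 0) (A k) (B k) (at d 0) (cong proj₁ φd≡Rw) ⟩
      at d 0                                            ∎
      where
      open ≡-Reasoning
      solve : ∀ s q w₁ w₂ σ a b d → d + q * σ ≡ (s - q * a) * w₁ + (- + 1 - q * b) * w₂ →
              s * w₁ - w₂ - q * (σ + (w₁ * a + w₂ * b)) ≡ d
      solve s q w₁ w₂ σ a b d eq =
        trans (expand s q w₁ w₂ σ a b) (trans (cong (λ x → x - q * σ) (sym eq)) (cancel d q σ))
        where
        expand : ∀ s q w₁ w₂ σ a b →
          s * w₁ - w₂ - q * (σ + (w₁ * a + w₂ * b)) ≡ (s - q * a) * w₁ + (- + 1 - q * b) * w₂ - q * σ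
        expand = solve-∀
        cancel : ∀ d q σ → d + q * σ - q * σ ≡ d
        cancel = solve-∀

    row-v₂ : at (L ·ᴹ z) 1 ≡ at d 1
    row-v₂ = begin
      at (L ·ᴹ z) 1                                     ≡⟨ row₁ z ⟩
      D * rim z 0 - w₁ - + q * rim z 1
        ≡⟨ cong₂ (λ r₀ r₁ → D * r₀ - w₁ - + q * r₁) (trans (rim≡τ 0 z≤n) τ₀) (trans (rim≡τ 1 (s≤s z≤n)) τ₁) ⟩
      D * (σ d 0 + (w₁ * A k + w₂ * B k)) - w₁ - + q * (σ d 1 + (w₁ * A k′ + w₂ * B k′))
        ≡⟨ solve D (+ q) w₁ w₂ (σ d 0) (σ d 1) (A k) (B k) (A k′) (B k′) (at d 1) (cong proj₂ φd≡Rw) ⟩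
      at d 1                                            ∎
      where
      open ≡-Reasoning
      solve : ∀ D q w₁ w₂ σ₀ σ₁ a b a′ b′ d →
              d - D * σ₀ + q * σ₁ ≡ (D * a - + 1 - q * a′) * w₁ + (D * b - q * b′) * w₂ →
              D * (σ₀ + (w₁ * a + w₂ * b)) - w₁ - q * (σ₁ + (w₁ * a′ + w₂ * b′)) ≡ d
      solve D q w₁ w₂ σ₀ σ₁ a b a′ b′ d eq =
        trans (expand D q w₁ w₂ σ₀ σ₁ a b a′ b′) (trans (cong (λ x → x + D * σ₀ - q * σ₁) (sym eq)) (cancel d D q σ₀ σ₁))
        where
        expand : ∀ D q w₁ w₂ σ₀ σ₁ a b a′ b′ →
          D * (σ₀ + (w₁ * a + w₂ * b)) - w₁ - q * (σ₁ + (w₁ * a′ + w₂ * b′))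
            ≡ (D * a - + 1 - q * a′) * w₁ + (D * b - q * b′) * w₂ + D * σ₀ - q * σ₁
        expand = solve-∀
        cancel : ∀ d D q σ₀ σ₁ → d - D * σ₀ + q * σ₁ + D * σ₀ - q * σ₁ ≡ d
        cancel = solve-∀

    row-inner : ∀ {m} → m < k′ → at (L ·ᴹ z) (suc (suc m)) ≡ inner d m
    row-inner {m} m<k′ = begin
      at (L ·ᴹ z) (suc (suc m))                         ≡⟨ row₂₊ z m<k′ ⟩
      D * rim z (suc m) - rim z m - + q * rim z (suc (suc m))
        ≡⟨ cong-row (rim≡τ (suc m) (s≤s (ℕₚ.<⇒≤ m<k′))) (rim≡τ m (ℕₚ.m≤n⇒m≤1+n (ℕₚ.<⇒≤ m<k′)))
                 (rim≡τ (suc (suc m)) (s≤s m<k′)) ⟩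
      D * τ (suc m) - τ m - + q * τ (suc (suc m))
        ≡⟨ cong (λ r → D * τ (suc m) - r - + q * τ (suc (suc m))) (back-rec k′ w₂ w₁ (inner d) m<k′) ⟩
      D * τ (suc m) - (D * τ (suc m) - + q * τ (suc (suc m)) - inner d m) - + q * τ (suc (suc m))
        ≡⟨ cancel D (+ q) (τ (suc m)) (τ (suc (suc m))) (inner d m) ⟩
      inner d m                                         ∎
      where
      open ≡-Reasoning
      cong-row : ∀ {a a′ b b′ c c′} → a ≡ a′ → b ≡ b′ → c ≡ c′ → D * a - b - + q * c ≡ D * a′ - b′ - + q * c′
      cong-row refl refl refl = refl
      cancel : ∀ D q a b x → D * a - (D * a - q * b - x) - q * b ≡ x
      cancel = solve-∀

    kernel : ∀ i → d i ≡ (L ·ᴹ z) i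
    kernel i = begin
      d i                 ≡⟨ at-toℕ d i ⟨
      at d (toℕ i)        ≡⟨ rows (toℕ i) (toℕ<n i) ⟩
      at (L ·ᴹ z) (toℕ i) ≡⟨ at-toℕ (L ·ᴹ z) i ⟩
      (L ·ᴹ z) i          ∎
      where
      open ≡-Reasoning
      rows : ∀ m → m < suc k → at d m ≡ at (L ·ᴹ z) m
      rows zero                _                   = sym row-v₁
      rows (suc zero)          _                   = sym row-v₂
      rows (suc (suc m)) (s≤s (s≤s m<k′)) = sym (row-inner m<k′)

  σ-vanishes : ∀ x → (∀ m → inner x m ≡ + 0) → σ x 0 ≡ + 0 × σ x 1 ≡ + 0
  σ-vanishes x inner≡0 =
    trans (σ≡ 0) (trans (homogeneous₀ (+ 0) (+ 0)) (ℤₚ.+-identityʳ _)) ,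
    trans (σ≡ 1) (trans (homogeneous₁ (+ 0) (+ 0)) (ℤₚ.+-identityʳ _))
    where
    σ≡ : ∀ i → σ x i ≡ back k′ (+ 0) (+ 0) (λ _ → + 0) i
    σ≡ = back-cong k′ refl refl inner≡0

  ψ : ℤ² → Fin (suc k) → ℤ
  ψ (v₁ , v₂) = vec v₁ (extend v₂ (λ _ → + 0))

  ψ-inner : ∀ v m → inner (ψ v) m ≡ + 0
  ψ-inner (v₁ , v₂) m with suc (suc m) ℕ.<? suc k
  ... | yes 2+m<1+k = at-tabulate (extend v₁ (extend v₂ (λ _ → + 0))) 2+m<1+k
  ... | no  2+m≮1+k = at-≥ (ψ (v₁ , v₂)) (ℕₚ.≮⇒≥ 2+m≮1+k)

  φ-ψ : ∀ v → φ (ψ v) ≡ v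
  φ-ψ (v₁ , v₂) with σ-vanishes (ψ (v₁ , v₂)) (ψ-inner (v₁ , v₂))
  ... | σ₀≡0 , σ₁≡0 = cong₂ _,_
    (trans (cong (λ s → v₁ + + q * s) σ₀≡0) (vanish₁ v₁ (+ q)))
    (trans (cong₂ (λ s s′ → v₂ - D * s + + q * s′) σ₀≡0 σ₁≡0) (vanish₂ v₂ D (+ q)))
    where
    vanish₁ : ∀ v q → v + q * + 0 ≡ v
    vanish₁ = solve-∀
    vanish₂ : ∀ v d q → v - d * + 0 + q * + 0 ≡ v
    vanish₂ = solve-∀

  φ-zero : φ (λ _ → + 0) ≡ 0²
  φ-zero with σ-vanishes (λ _ → + 0) (λ m → at-zero {suc k} (suc (suc m)))
  ... | σ₀≡0 , σ₁≡0 = cong₂ _,_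
    (trans (cong (λ s → + 0 + + q * s) σ₀≡0) (trans (ℤₚ.+-identityˡ _) (ℤₚ.*-zeroʳ (+ q))))
    (trans (cong₂ (λ s s′ → + 0 - D * s + + q * s′) σ₀≡0 σ₁≡0) (vanish D (+ q)))
    where
    vanish : ∀ d q → + 0 - d * + 0 + q * + 0 ≡ + 0
    vanish = solve-∀

  φ-neg : ∀ x → φ (λ i → - x i) ≡ -² φ x
  φ-neg x = inverse (begin
    φ (λ i → - x i) +² φ x      ≡⟨ φ-+ (λ i → - x i) x ⟨
    φ (λ i → - x i + x i)       ≡⟨ φ-cong (λ i → ℤₚ.+-inverseˡ (x i)) ⟩
    φ (λ _ → + 0)               ≡⟨ φ-zero ⟩
    0²                          ∎)
    where
    open ≡-Reasoning
    inverse : ∀ {u v : ℤ²} → u +² v ≡ 0² → u ≡ -² v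
    inverse {u₁ , u₂} {v₁ , v₂} u+v≡0 = cong₂ _,_
      (trans (solve₁ u₁ v₁) (trans (cong (λ s → s - v₁) (cong proj₁ u+v≡0)) (ℤₚ.+-identityˡ _)))
      (trans (solve₁ u₂ v₂) (trans (cong (λ s → s - v₂) (cong proj₂ u+v≡0)) (ℤₚ.+-identityˡ _)))
      where
      solve₁ : ∀ u v → u ≡ u + v - v
      solve₁ = solve-∀

  φ-difference : ∀ x y → φ x ≡ φ (λ i → x i - y i) +² φ y
  φ-difference x y = trans (φ-cong (λ i → regroup (x i) (y i))) (φ-+ (λ i → x i - y i) y)
    where
    regroup : ∀ x y → x ≡ x - y + y
    regroup = solve-∀

  cancel² : ∀ {x u y : ℤ²} → x ≡ u +² y → x -² y ≡ u
  cancel² {x₁ , x₂} {u₁ , u₂} {y₁ , y₂} x≡u+y = cong₂ _,_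
    (trans (cong (λ s → s - y₁) (cong proj₁ x≡u+y)) (cancel u₁ y₁))
    (trans (cong (λ s → s - y₂) (cong proj₂ x≡u+y)) (cancel u₂ y₂))
    where
    cancel : ∀ u y → u + y - y ≡ u
    cancel = solve-∀

  K≅Coker₂ : K q t k ≅ Coker₂ R
  K≅Coker₂ = isomorphism {K q t k} {Coker₂ R} φ (λ {x} {y} → φ-congruent {x} {y})
    (λ x y → Coker₂-reflexive R {φ (λ i → x i + y i)} (φ-+ x y))
    (Coker₂-reflexive R {φ (λ _ → + 0)} φ-zero)
    (λ x → Coker₂-reflexive R {φ (λ i → - x i)} (φ-neg x))
    (λ {x} {y} → φ-injective {x} {y}) φ-surjective
    where
    open RawGroup (K q t k) using () renaming (_≈_ to _≈ᴷ_)
    open RawGroup (Coker₂ R) using () renaming (_≈_ to _≈ᶜ_)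
    φ-congruent : Congruent _≈ᴷ_ _≈ᶜ_ φ
    φ-congruent {x} {y} (z , x-y≡Lz) = (at z 0 , at z k) , cancel² (begin
      φ x                                   ≡⟨ φ-difference x y ⟩
      φ (λ i → x i - y i) +² φ y             ≡⟨ cong (_+² φ y) (φ-cong x-y≡Lz) ⟩
      φ (L ·ᴹ z) +² φ y                      ≡⟨ cong (_+² φ y) (φ-L z) ⟩
      R · (at z 0 , at z k) +² φ y           ∎)
      where open ≡-Reasoning
    φ-injective : Injective _≈ᴷ_ _≈ᶜ_ φ
    φ-injective {x} {y} ((w₁ , w₂) , φx-φy≡Rw) = Kernel.z d w₁ w₂ φd≡Rw , Kernel.kernel d w₁ w₂ φd≡Rw
      where
      d : Fin (suc k) → ℤ
      d i = x i - y i
      φd≡Rw : φ d ≡ R · (w₁ , w₂)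
      φd≡Rw = trans (sym (cancel² (φ-difference x y))) φx-φy≡Rw
    φ-surjective : Surjective _≈ᴷ_ _≈ᶜ_ φ
    φ-surjective v = ψ v , λ {z} z≈ψv →
      subst (φ z ≈ᶜ_) (φ-ψ v) (φ-congruent {z} {ψ v} z≈ψv)

  K-refl : ∀ x → RawGroup._≈_ (K q t k) x x
  K-refl x = (λ _ → + 0) , λ i → trans (ℤₚ.+-inverseʳ (x i)) (sym (·ᴹ-zero L i))

-- The entries of the relation matrix

Qk-suc : ∀ q n → Qk q (suc n) ≡ 1 ℕ.+ q ℕ.* Qk q n
Qk-suc q zero    = refl
Qk-suc q (suc n) = trans (cong (ℕ._+ q ℕ.^ suc (suc n)) (Qk-suc q n)) (factor q (Qk q n) (q ℕ.^ suc n))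
  where
  factor : ∀ q a b → 1 ℕ.+ q ℕ.* a ℕ.+ q ℕ.* b ≡ 1 ℕ.+ q ℕ.* (a ℕ.+ b)
  factor = ℕ-Ring.solve-∀

pos-m[m∸1] : ∀ m → + (m ℕ.* (m ∸ 1)) ≡ + m * (+ m - + 1)
pos-m[m∸1] zero    = refl
pos-m[m∸1] (suc m) = ℤₚ.pos-* (suc m) m

pos-^ : ∀ m n → + (m ℕ.^ n) ≡ (+ m) ℤ.^ n
pos-^ m zero    = refl
pos-^ m (suc n) = trans (ℤₚ.pos-* m (m ℕ.^ n)) (cong (+ m *_) (pos-^ m n))

module Entries (q t k′ : ℕ) where
  open Wheel q t k′ using (k; D)
  open Reduction q t k′
  open Recurrence D (+ q)

  D-split : D ≡ + t + + 1 + + q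
  D-split = trans (ℤₚ.pos-+ (t ℕ.+ 1) q) (cong (_+ + q) (ℤₚ.pos-+ t 1))

  A-shift : ∀ n → A (suc n) ≡ - + q * B n
  A-shift zero          = sym (ℤₚ.*-zeroʳ (- + q))
  A-shift (suc zero)    = start D (+ q)
    where
    start : ∀ d q → d * + 0 - q * + 1 ≡ - q * + 1
    start = solve-∀
  A-shift (suc (suc n)) = trans (cong₂ (λ a a′ → D * a - + q * a′) (A-shift (suc n)) (A-shift n))
                                (factor D (+ q) (B (suc n)) (B n))
    where
    factor : ∀ d q b₁ b₀ → d * (- q * b₁) - q * (- q * b₀) ≡ - q * (d * b₁ - q * b₀)
    factor = solve-∀

  corner : ℤ
  corner = + suc q + + q * + q * B k′

  off : ℤ
  off = - + 1 - + q * B k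

  R-entries : R ≡ mat corner off off (B (suc k))
  R-entries = mat-≡
    (trans (cong (λ a → + suc q - + q * a) (A-shift k′)) (square (+ suc q) (+ q) (B k′)))
    refl
    (trans (regroup D (A k) (+ q) (A k′)) (trans (cong (_- + 1) (A-shift k)) (swap (+ q) (B k))))
    refl
    where
    square : ∀ s q b → s - q * (- q * b) ≡ s + q * q * b
    square = solve-∀
    regroup : ∀ d a q a′ → d * a - + 1 - q * a′ ≡ (d * a - q * a′) - + 1
    regroup = solve-∀
    swap : ∀ q b → - q * b - + 1 ≡ - + 1 - q * b
    swap = solve-∀

  -- B n ≡ Q_{n-1} modulo t, since D ≡ 1 + q
  Q′ : ℕ → ℤ
  Q′ zero    = + 0
  Q′ (suc n) = + Qk q n

  Q′-suc : ∀ n → Q′ (suc n) ≡ + 1 + + q * Q′ n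
  Q′-suc zero    = sym (trans (cong (λ x → + 1 + x) (ℤₚ.*-zeroʳ (+ q))) (ℤₚ.+-identityʳ (+ 1)))
  Q′-suc (suc n) = trans (cong +_ (Qk-suc q n)) (trans (ℤₚ.pos-+ 1 (q ℕ.* Qk q n)) (cong (λ x → + 1 + x) (ℤₚ.pos-* q (Qk q n))))

  carry : ℕ → ℤ
  carry zero          = + 0
  carry (suc zero)    = + 0
  carry (suc (suc n)) = D * carry (suc n) - + q * carry n + Q′ (suc n)

  B-mod-t : ∀ n → B n ≡ Q′ n + + t * carry n
  B-mod-t zero          = sym (trans (ℤₚ.+-identityˡ _) (ℤₚ.*-zeroʳ (+ t)))
  B-mod-t (suc zero)    = sym (trans (cong (λ x → + 1 + x) (ℤₚ.*-zeroʳ (+ t))) (ℤₚ.+-identityʳ (+ 1)))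
  B-mod-t (suc (suc n)) =
    trans (cong₂ (λ b₁ b₀ → D * b₁ - + q * b₀) (B-mod-t (suc n)) (B-mod-t n))
          (step D (+ t) (+ q) _ _ _ (carry (suc n)) (carry n) D-split (Q′-suc n) (Q′-suc (suc n)))
    where
    step : ∀ d t q p₂ p₁ p₀ c₁ c₀ → d ≡ t + + 1 + q → p₁ ≡ + 1 + q * p₀ → p₂ ≡ + 1 + q * p₁ →
           d * (p₁ + t * c₁) - q * (p₀ + t * c₀) ≡ p₂ + t * (d * c₁ - q * c₀ + p₁)
    step _ t q _ _ p₀ c₁ c₀ refl refl refl = identity t q p₀ c₁ c₀
      where
      identity : ∀ t q p₀ c₁ c₀ →
        (t + + 1 + q) * (+ 1 + q * p₀ + t * c₁) - q * (p₀ + t * c₀)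
          ≡ + 1 + q * (+ 1 + q * p₀) + t * ((t + + 1 + q) * c₁ - q * c₀ + (+ 1 + q * p₀))
      identity = solve-∀

  Qz : ℤ
  Qz = + Qk q k

  corner-mod-t : corner ≡ Qz + + t * (+ q * + q * carry k′)
  corner-mod-t = trans (cong (λ b → + suc q + + q * + q * b) (B-mod-t k′))
                       (step (+ suc q) (+ q) (+ t) _ _ _ (carry k′) (ℤₚ.pos-+ 1 q) (Q′-suc k) (Q′-suc k′))
    where
    step : ∀ s q t p₂ p₁ p₀ c → s ≡ + 1 + q → p₂ ≡ + 1 + q * p₁ → p₁ ≡ + 1 + q * p₀ →
           s + q * q * (p₀ + t * c) ≡ p₂ + t * (q * q * c)
    step _ q t _ _ p₀ c refl refl refl = identity q t p₀ c
      where
      identity : ∀ q t p₀ c → + 1 + q + q * q * (p₀ + t * c) ≡ + 1 + q * (+ 1 + q * p₀) + t * (q * q * c)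
      identity = solve-∀

  off-mod-t : off ≡ - Qz + + t * (- + q * carry k)
  off-mod-t = trans (cong (λ b → - + 1 - + q * b) (B-mod-t k))
                    (step (+ q) (+ t) _ _ (carry k) (Q′-suc k))
    where
    step : ∀ q t p₂ p₁ c → p₂ ≡ + 1 + q * p₁ → - + 1 - q * (p₁ + t * c) ≡ - p₂ + t * (- q * c)
    step q t _ p₁ c refl = identity q t p₁ c
      where
      identity : ∀ q t p₁ c → - + 1 - q * (p₁ + t * c) ≡ - (+ 1 + q * p₁) + t * (- q * c)
      identity = solve-∀

  t-combination : + t ≡ - corner - D * off - + q * B (suc k)
  t-combination = step D (+ t) (+ q) (+ suc q) (B k) (B k′) D-split (ℤₚ.pos-+ 1 q)
    where
    step : ∀ d t q s b₁ b₀ → d ≡ t + + 1 + q → s ≡ + 1 + q →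
           t ≡ - (s + q * q * b₀) - d * (- + 1 - q * b₁) - q * (d * b₁ - q * b₀)
    step _ t q _ b₁ b₀ refl refl = identity t q b₁ b₀
      where
      identity : ∀ t q b₁ b₀ →
        t ≡ - (+ 1 + q + q * q * b₀) - (t + + 1 + q) * (- + 1 - q * b₁) - q * ((t + + 1 + q) * b₁ - q * b₀)
      identity = solve-∀

  ∣ᴹR⇒ : ∀ {m} → m ∣ᴹ R → m ∣ + t × m ∣ Qz
  ∣ᴹR⇒ {m} m∣R = divides-t , divides-Qz
    where
    m∣entries : m ∣ᴹ mat corner off off (B (suc k))
    m∣entries = subst (m ∣ᴹ_) R-entries m∣R
    m∣corner : m ∣ corner
    m∣corner = proj₁ m∣entries
    m∣off : m ∣ off
    m∣off    = proj₁ (proj₂ m∣entries)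
    m∣last : m ∣ B (suc k)
    m∣last   = proj₂ (proj₂ (proj₂ m∣entries))
    divides-t : m ∣ + t
    divides-t = subst (m ∣_) (sym t-combination)
      (∣m∣n⇒∣m-n (∣m∣n⇒∣m-n (∣m⇒∣-m m∣corner) (∣n⇒∣m*n D m∣off)) (∣n⇒∣m*n (+ q) m∣last))
    divides-Qz : m ∣ Qz
    divides-Qz = subst (m ∣_) (isolate (B-mod-t (suc k))) (∣m∣n⇒∣m-n m∣last (∣m⇒∣m*n (carry (suc k)) divides-t))
      where
      isolate : ∀ {b p c} → b ≡ p + + t * c → b - + t * c ≡ p
      isolate {c = c} refl = cancel _ (+ t) c
        where
        cancel : ∀ p t c → p + t * c - t * c ≡ p
        cancel = solve-∀

  ⇒∣ᴹR : ∀ {m} → m ∣ + t → m ∣ Qz → m ∣ᴹ R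
  ⇒∣ᴹR {m} m∣t m∣Qz = subst (m ∣ᴹ_) (sym R-entries)
    ( subst (m ∣_) (sym corner-mod-t) (∣m∣n⇒∣m+n m∣Qz (∣m⇒∣m*n _ m∣t))
    , m∣off , m∣off
    , subst (m ∣_) (sym (B-mod-t (suc k))) (∣m∣n⇒∣m+n m∣Qz (∣m⇒∣m*n _ m∣t)) )
    where
    m∣off : m ∣ off
    m∣off = subst (m ∣_) (sym off-mod-t) (∣m∣n⇒∣m+n (∣m⇒∣-m m∣Qz) (∣m⇒∣m*n _ m∣t))

  -- ℕ-valued companions of B (see B≡b), for which positivity is evident.
  b g : ℕ → ℕ
  b zero    = 0
  b (suc j) = b j ℕ.+ g j ℕ.+ q ℕ.^ j
  g zero    = 0
  g (suc j) = q ℕ.* g j ℕ.+ t ℕ.* b (suc j)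

  b-suc : ∀ j → + b (suc j) ≡ + b j + + g j + (+ q) ℤ.^ j
  b-suc j = trans (ℤₚ.pos-+ (b j ℕ.+ g j) (q ℕ.^ j))
                  (cong₂ _+_ (ℤₚ.pos-+ (b j) (g j)) (pos-^ q j))

  g-suc : ∀ j → + g (suc j) ≡ + q * + g j + + t * + b (suc j)
  g-suc j = trans (ℤₚ.pos-+ (q ℕ.* g j) (t ℕ.* b (suc j)))
                  (cong₂ _+_ (ℤₚ.pos-* q (g j)) (ℤₚ.pos-* t (b (suc j))))

  B≡b : ∀ j → B j ≡ + b j
  B≡b zero          = refl
  B≡b (suc zero)    = refl
  B≡b (suc (suc j)) =
    trans (cong₂ (λ b₁ b₀ → D * b₁ - + q * b₀) (B≡b (suc j)) (B≡b j))
          (step D (+ t) (+ q) _ _ _ _ _ D-split (b-suc (suc j)) (g-suc j) (b-suc j))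
    where
    step : ∀ d t q b₂ b₁ b₀ g₁ g₀ → d ≡ t + + 1 + q →
           b₂ ≡ b₁ + g₁ + q ℤ.^ suc j → g₁ ≡ q * g₀ + t * b₁ → b₁ ≡ b₀ + g₀ + q ℤ.^ j →
           d * b₁ - q * b₀ ≡ b₂
    step _ t q _ _ b₀ _ g₀ refl refl refl refl = identity t q b₀ g₀ (q ℤ.^ j)
      where
      identity : ∀ t q b₀ g₀ p →
        (t + + 1 + q) * (b₀ + g₀ + p) - q * b₀ ≡ b₀ + g₀ + p + (q * g₀ + t * (b₀ + g₀ + p)) + q * p
      identity = solve-∀

  F : ℕ → ℤ
  F j = + suc q * B (suc j) - + 2 * + q * B j - + 1 - (+ q) ℤ.^ suc j

  det-R : det R ≡ F k
  det-R = trans (cong det R-entries) (step (+ suc q) (+ q) (B k′) (B k) (B (suc k)) _ (cassini k′))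
    where
    step : ∀ s q b′ b b₊ p → b * b - b′ * b₊ ≡ p →
           (s + q * q * b′) * b₊ - (- + 1 - q * b) * (- + 1 - q * b) ≡ s * b₊ - + 2 * q * b - + 1 - q * (q * p)
    step s q b′ b b₊ p cassini-eq =
      trans (expand s q b′ b b₊) (cong (λ x → s * b₊ - + 2 * q * b - + 1 - q * (q * x)) cassini-eq)
      where
      expand : ∀ s q b′ b b₊ → (s + q * q * b′) * b₊ - (- + 1 - q * b) * (- + 1 - q * b)
                                 ≡ s * b₊ - + 2 * q * b - + 1 - q * (q * (b * b - b′ * b₊))
      expand = solve-∀

  f : ℕ → ℕ
  f zero    = 0
  f (suc j) = f j ℕ.+ suc q ℕ.* t ℕ.* b (suc j) ℕ.+ q ℕ.* (q ∸ 1) ℕ.* g j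

  f-suc : ∀ j → + f (suc j) ≡ + f j + + suc q * + t * + b (suc j) + + q * (+ q - + 1) * + g j
  f-suc j = trans (ℤₚ.pos-+ (f j ℕ.+ suc q ℕ.* t ℕ.* b (suc j)) (q ℕ.* (q ∸ 1) ℕ.* g j))
    (cong₂ _+_ (trans (ℤₚ.pos-+ (f j) (suc q ℕ.* t ℕ.* b (suc j)))
                      (cong (λ x → + f j + x) (trans (ℤₚ.pos-* (suc q ℕ.* t) (b (suc j)))
                                                     (cong (_* + b (suc j)) (ℤₚ.pos-* (suc q) t)))))
               (trans (ℤₚ.pos-* (q ℕ.* (q ∸ 1)) (g j)) (cong (_* + g j) (pos-m[m∸1] q))))

  F≡f : ∀ j → F j ≡ + f j
  F≡f zero    = start (+ suc q) (+ q) (ℤₚ.pos-+ 1 q)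
    where
    start : ∀ s q → s ≡ + 1 + q → s * + 1 - + 2 * q * + 0 - + 1 - q * + 1 ≡ + 0
    start _ q refl = identity q
      where
      identity : ∀ q → (+ 1 + q) * + 1 - + 2 * q * + 0 - + 1 - q * + 1 ≡ + 0
      identity = solve-∀
  F≡f (suc j) = begin
    F (suc j)
      ≡⟨ cong₂ (λ b₂ b₁ → + suc q * b₂ - + 2 * + q * b₁ - + 1 - (+ q) ℤ.^ suc (suc j)) (B≡b (suc (suc j))) (B≡b (suc j)) ⟩
    + suc q * + b (suc (suc j)) - + 2 * + q * + b (suc j) - + 1 - (+ q) ℤ.^ suc (suc j)
      ≡⟨ step (+ suc q) (+ q) (+ t) _ _ (+ b j) _ (+ g j) ((+ q) ℤ.^ j) (ℤₚ.pos-+ 1 q)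
              (b-suc (suc j)) (g-suc j) (b-suc j) ⟩
    (+ suc q * + b (suc j) - + 2 * + q * + b j - + 1 - (+ q) ℤ.^ suc j)
      + + suc q * + t * + b (suc j) + + q * (+ q - + 1) * + g j
      ≡⟨ cong₂ (λ b₁ b₀ → (+ suc q * b₁ - + 2 * + q * b₀ - + 1 - (+ q) ℤ.^ suc j)
                          + + suc q * + t * + b (suc j) + + q * (+ q - + 1) * + g j)
               (B≡b (suc j)) (B≡b j) ⟨
    F j + + suc q * + t * + b (suc j) + + q * (+ q - + 1) * + g j
      ≡⟨ cong (λ x → x + + suc q * + t * + b (suc j) + + q * (+ q - + 1) * + g j) (F≡f j) ⟩
    + f j + + suc q * + t * + b (suc j) + + q * (+ q - + 1) * + g j
      ≡⟨ f-suc j ⟨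
    + f (suc j) ∎
    where
    open ≡-Reasoning
    step : ∀ s q t b₂ b₁ b₀ g₁ g₀ p → s ≡ + 1 + q →
           b₂ ≡ b₁ + g₁ + q * p → g₁ ≡ q * g₀ + t * b₁ → b₁ ≡ b₀ + g₀ + p →
           s * b₂ - + 2 * q * b₁ - + 1 - q * (q * p)
             ≡ (s * b₁ - + 2 * q * b₀ - + 1 - q * p) + s * t * b₁ + q * (q - + 1) * g₀
    step _ q t _ _ b₀ _ g₀ p refl refl refl refl = identity q t b₀ g₀ p
      where
      identity : ∀ q t b₀ g₀ p →
        (+ 1 + q) * (b₀ + g₀ + p + (q * g₀ + t * (b₀ + g₀ + p)) + q * p) - + 2 * q * (b₀ + g₀ + p) - + 1 - q * (q * p)
          ≡ ((+ 1 + q) * (b₀ + g₀ + p) - + 2 * q * b₀ - + 1 - q * p) + (+ 1 + q) * t * (b₀ + g₀ + p) + q * (q - + 1) * g₀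
      identity = solve-∀

  b-positive : ∀ j → 1 ≤ b (suc j)
  b-positive zero    = ℕₚ.≤-refl
  b-positive (suc j) = ℕₚ.≤-trans (b-positive j)
    (ℕₚ.≤-trans (ℕₚ.m≤m+n (b (suc j)) (g (suc j))) (ℕₚ.m≤m+n _ (q ℕ.^ suc j)))

  f-positive : 1 ≤ t → ∀ j → 1 ≤ f (suc j)
  f-positive 1≤t j = ℕₚ.≤-trans 1≤growth
    (ℕₚ.≤-trans (ℕₚ.m≤n+m _ (f j)) (ℕₚ.m≤m+n _ (q ℕ.* (q ∸ 1) ℕ.* g j)))
    where
    1≤growth : 1 ≤ suc q ℕ.* t ℕ.* b (suc j)
    1≤growth = ℕₚ.*-mono-≤ {1} {suc q ℕ.* t} {1} {b (suc j)}
                 (ℕₚ.*-mono-≤ {1} {suc q} {1} {t} (s≤s z≤n) 1≤t) (b-positive j)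

  det-R≢0 : 1 ≤ t → det R ≢ + 0
  det-R≢0 1≤t detR≡0 = ℕₚ.n≮0 (subst (1 ≤_) f≡0 (f-positive 1≤t k′))
    where
    f≡0 : f k ≡ 0
    f≡0 = ℤₚ.+-injective (trans (sym (trans det-R (F≡f k))) detR≡0)

  corner≢0 : Mat₂.a R ≢ + 0
  corner≢0 a≡0 = ℕₚ.1+n≢0 (ℤₚ.+-injective (trans (sym corner-pos) (trans (sym (cong Mat₂.a R-entries)) a≡0)))
    where
    corner-pos : corner ≡ + (suc q ℕ.+ q ℕ.* q ℕ.* b k′)
    corner-pos = trans (cong (λ x → + suc q + + q * + q * x) (B≡b k′))
      (sym (trans (ℤₚ.pos-+ (suc q) (q ℕ.* q ℕ.* b k′))
                  (cong (λ x → + suc q + x) (trans (ℤₚ.pos-* (q ℕ.* q) (b k′)) (cong (_* + b k′) (ℤₚ.pos-* q q))))))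

-- The classification

module Classification (q t k′ : ℕ) (1≤t : 1 ≤ t) (S : SmithForm (Reduction.R q t k′)) where
  open Wheel q t k′ using (k)
  open Reduction q t k′ using (R; K≅Coker₂)
  open Entries q t k′ using (det-R≢0; ∣ᴹR⇒; ⇒∣ᴹR)
  open SmithForm S
  open SmithForm-properties S

  private
    G : ℕ
    G = gcd t (Qk q k)

  ∣e∣≡gcd : ℤ.∣ e ∣ ≡ G
  ∣e∣≡gcd = ℕᵈ.∣-antisym ∣e∣∣G G∣∣e∣
    where
    ∣e∣∣G : ℤ.∣ e ∣ ℕᵈ.∣ G
    ∣e∣∣G = gcd-greatest (∣⇒∣ᵤ (proj₁ (∣ᴹR⇒ e∣ᴹ))) (∣⇒∣ᵤ (proj₂ (∣ᴹR⇒ e∣ᴹ)))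
    G∣∣e∣ : G ℕᵈ.∣ ℤ.∣ e ∣
    G∣∣e∣ = ∣⇒∣ᵤ (∣ᴹ⇒∣e (⇒∣ᴹR (∣ᵤ⇒∣ {+ G} {+ t} (gcd[m,n]∣m t (Qk q k)))
                               (∣ᵤ⇒∣ {+ G} {+ Qk q k} (gcd[m,n]∣n t (Qk q k)))))

  d₂ : ℕ
  d₂ = ℤ.∣ _∣_.quotient e∣f ∣

  ∣f∣≡gcd*d₂ : ℤ.∣ f ∣ ≡ G ℕ.* d₂
  ∣f∣≡gcd*d₂ = begin
    ℤ.∣ f ∣                       ≡⟨ cong ℤ.∣_∣ (_∣_.equality e∣f) ⟩
    ℤ.∣ _∣_.quotient e∣f * e ∣    ≡⟨ ℤₚ.abs-* (_∣_.quotient e∣f) e ⟩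
    d₂ ℕ.* ℤ.∣ e ∣                ≡⟨ cong (d₂ ℕ.*_) ∣e∣≡gcd ⟩
    d₂ ℕ.* G                      ≡⟨ ℕₚ.*-comm d₂ G ⟩
    G ℕ.* d₂                      ∎
    where open ≡-Reasoning

  1≤d₂ : 1 ≤ d₂
  1≤d₂ = ℕₚ.n≢0⇒n>0 λ d₂≡0 → det-R≢0 1≤t (begin
    det R    ≡⟨ product≡det ⟨
    e * f    ≡⟨ cong (e *_) (ℤₚ.∣i∣≡0⇒i≡0 (trans ∣f∣≡gcd*d₂ (trans (cong (G ℕ.*_) d₂≡0) (ℕₚ.*-zeroʳ G)))) ⟩
    e * + 0  ≡⟨ ℤₚ.*-zeroʳ e ⟩
    + 0      ∎)
    where open ≡-Reasoning

  K≅ZMod×ZMod : K q t k ≅ (ZMod G ×G ZMod (G ℕ.* d₂))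
  K≅ZMod×ZMod = subst₂ (λ m n → K q t k ≅ (ZMod m ×G ZMod n)) ∣e∣≡gcd ∣f∣≡gcd*d₂
    (≅-trans (λ {x} {y} {z} → ZMod×-trans {i = x} {y} {z}) K≅Coker₂
      (≅-trans (λ {x} {y} {z} → ZMod×-trans {i = x} {y} {z}) (_∼_.coker≅ equivalent) (Coker₂-diagonal e f)))

theorem11 : (q t k : ℕ) → 1 ≤ t → 1 ≤ k →
    (gcd t (Qk q k) ≡ 1 → Cyclic (K q t k)) ×
    (gcd t (Qk q k) ≢ 1 →
    ∃ λ (d₂ : ℕ) → 1 ≤ d₂ ×
    (K q t k ≅ (ZMod (gcd t (Qk q k)) ×G ZMod (gcd t (Qk q k) ℕ.* d₂))))
theorem11 q t (suc k′) 1≤t _ = cyclic , bicyclic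
  where
  open Classification q t k′ 1≤t (smith (Reduction.R q t k′) (Entries.corner≢0 q t k′))
  G : ℕ
  G = gcd t (Qk q (suc k′))
  cyclic : G ≡ 1 → Cyclic (K q t (suc k′))
  cyclic G≡1 = Cyclic-≅ZMod {K q t (suc k′)} {1 ℕ.* d₂} (Reduction.K-refl q t k′)
    (≅-trans {K q t (suc k′)} {ZMod 1 ×G ZMod (1 ℕ.* d₂)} {ZMod (1 ℕ.* d₂)}
       (λ {x} {y} {z} → ZMod-trans {1 ℕ.* d₂} {x} {y} {z})
       (subst (λ m → K q t (suc k′) ≅ (ZMod m ×G ZMod (m ℕ.* d₂))) G≡1 K≅ZMod×ZMod)
       (ZMod-one-× (1 ℕ.* d₂)))
  bicyclic : G ≢ 1 → ∃ λ (d₂ : ℕ) → 1 ≤ d₂ × (K q t (suc k′) ≅ (ZMod G ×G ZMod (G ℕ.* d₂)))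
  bicyclic _ = d₂ , 1≤d₂ , K≅ZMod×ZMod
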